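{- For a positive integer $a$ let $\alpha = a^{ -1}$ and $$RHS = \left[\frac{\{32a^2(a^2-1)-6\}\,(4a+1)/(4a)}{(4a^2+2)(4a^2+1)(4a^2-3)(a+1)}\right] \frac{\binom{8a^2-1}{4a^2-1}\binom{8a^2-5}{4a^2-1}}{\binom{8a^2+2a-1}{4a^2+a-1}\binom{8a^2-2a-5}{4a^2+a-1}}.$$ Then as $a \to \infty$ (so $\alpha\to 0$), $RHS = \tfrac{e}{2}\alpha^3 + o(\alpha^3)$, where $e$ is Euler's number. -}

module Defs where

open import Data.Nat as ℕ using (ℕ; zero; suc; _∸_; _^_)
open import Data.Nat.Combinatorics using (_C_)
open import Data.Integer as ℤ using (ℤ; +_)
open import Data.Rational using (ℚ; _/_; _+_; _*_; _-_; 0ℚ; 1ℚ)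

ℕ→ℚ : ℕ → ℚ
ℕ→ℚ n = + n / 1

ℤ→ℚ : ℤ → ℚ
ℤ→ℚ z = z / 1

-- division of a rational by a natural number; the value at 0 is a junk
-- convention (0) that is never used below (all divisors are ≥ 1 when a ≥ 1).
_÷ℕ_ : ℚ → ℕ → ℚ
q ÷ℕ zero    = 0ℚ
q ÷ℕ (suc n) = q * (+ 1 / suc n)

infixl 7 _÷ℕ_

RHS : ℕ → ℚ
RHS a = bracket * binomRatio
  where
  a2 : ℕ
  a2 = a ^ 2
  num : ℚ
  num = ℤ→ℚ ((+ (32 ℕ.* a2 ℕ.* (a2 ∸ 1))) ℤ.- (+ 6))
  bracket : ℚ
  bracket = (num * (ℕ→ℚ (4 ℕ.* a ℕ.+ 1) ÷ℕ (4 ℕ.* a)))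
            ÷ℕ ((4 ℕ.* a2 ℕ.+ 2) ℕ.* (4 ℕ.* a2 ℕ.+ 1) ℕ.* (4 ℕ.* a2 ∸ 3) ℕ.* (a ℕ.+ 1))
  binomRatio : ℚ
  binomRatio = ℕ→ℚ (((8 ℕ.* a2 ∸ 1) C (4 ℕ.* a2 ∸ 1)) ℕ.* ((8 ℕ.* a2 ∸ 5) C (4 ℕ.* a2 ∸ 1)))
               ÷ℕ (((8 ℕ.* a2 ℕ.+ 2 ℕ.* a ∸ 1) C (4 ℕ.* a2 ℕ.+ a ∸ 1))
                   ℕ.* ((8 ℕ.* a2 ∸ 2 ℕ.* a ∸ 5) C (4 ℕ.* a2 ℕ.+ a ∸ 1)))

-- partial sums of the exponential series: eSum m = Σ_{k=0}^{m} 1/k!  (→ e)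
eSum : ℕ → ℚ
eSum zero    = 1ℚ
eSum (suc m) = eSum m + (1ℚ ÷ℕ (suc m ℕ.!))

{-# OPTIONS --safe #-}
-- With K = 8a², the ratio of binomial coefficients in RHS(a) is a product of 10a factors (K ± j)/K
-- whose exponents ±j/K add up to 1 + 3/(2a). For E = expSum (m + 1), a partial sum of the
-- exponential series, a factor 1 ± x agrees with E(s ± x)/E(s) up to the relative error x(x + δ),
-- where δ = 2^m/m! bounds the last term of E on [0, 2]. Read along two walks of positions that
-- meet, the product telescopes to E(1 + 3/(2a)), which is E(1) = eSum m up to a relative error
-- O(1/a + 1/m). The bracket times a³ is 1/2 up to the relative error 2/a, so a³ RHS(a) agrees with
-- eSum m / 2 up to O(1/a + 1/m).
module Submission where

open import Defs

open import Data.Nat as ℕ using (ℕ; zero; suc; _∸_; _^_; _!)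
  renaming (_≤_ to _≤ℕ_; _<_ to _<ℕ_)
import Data.Nat.Properties as ℕₚ
open import Data.Product using (∃-syntax; _,_; _×_; proj₁; proj₂)
open import Relation.Binary.PropositionalEquality
open import Tactic.RingSolver using (solve-∀)
open import Data.Nat.Tactic.RingSolver using () renaming (ring to ℕ-ring)
open import Data.Nat.Combinatorics using (_C_)

-- Products and binomial coefficients

module Products where
  open import Data.Nat
  open import Data.Nat.Properties
  open import Data.Nat.Combinatorics using (_C_; nCk≡n!/k![n-k]!; k![n∸k]!∣n!)
  open import Data.Nat.DivMod using (m/n*n≡m)
  open import Data.Nat.Divisibility using (_∣_)
  open import Relation.Nullary.Negation using (contradiction)
  open ≡-Reasoning

  sumℕ : (ℕ → ℕ) → ℕ → ℕ
  sumℕ f zero    = 0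
  sumℕ f (suc k) = sumℕ f k + f k

  prodℕ : (ℕ → ℕ) → ℕ → ℕ
  prodℕ f zero    = 1
  prodℕ f (suc k) = prodℕ f k * f k

  m≡n+d⇒m∸d≡n : ∀ {m n} d → m ≡ n + d → m ∸ d ≡ n
  m≡n+d⇒m∸d≡n {n = n} d refl = m+n∸n≡m n d

  ≤-byRemainder : ∀ {m n} r → m + r ≡ n → m ≤ n
  ≤-byRemainder {m} r refl = m≤m+n m r

  ≤-byShift : ∀ b {x} (L R Q : ℕ → ℕ) → (∀ s → L (b + s) + Q s ≡ R (b + s)) → b ≤ x → L x ≤ R x
  ≤-byShift b L R Q identity b≤x with m≤n⇒∃[o]m+o≡n b≤x
  ... | s , refl = ≤-byRemainder (Q s) (identity s)

  progression : ℕ → ℕ → ℕ → ℕ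
  progression c d i = c + d * i

  sumℕ-progression : ∀ c d k → 2 * sumℕ (progression c d) k + d * k ≡ k * (2 * c + d * k)
  sumℕ-progression c d zero    = *-zeroʳ d
  sumℕ-progression c d (suc k) = begin
    2 * (Σ + (c + d * k)) + d * suc k            ≡⟨ regroup Σ c d k ⟩
    (2 * Σ + d * k) + (2 * c + 2 * d * k + d)    ≡⟨ cong (_+ (2 * c + 2 * d * k + d)) (sumℕ-progression c d k) ⟩
    k * (2 * c + d * k) + (2 * c + 2 * d * k + d) ≡⟨ expand c d k ⟩
    suc k * (2 * c + d * suc k)                  ∎
    where
    Σ : ℕ
    Σ = sumℕ (progression c d) k
    regroup : ∀ Σ c d k → 2 * (Σ + (c + d * k)) + d * suc k ≡ (2 * Σ + d * k) + (2 * c + 2 * d * k + d)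
    regroup = solve-∀ ℕ-ring
    expand : ∀ c d k → k * (2 * c + d * k) + (2 * c + 2 * d * k + d) ≡ suc k * (2 * c + d * suc k)
    expand = solve-∀ ℕ-ring

  prodℕ-cong : ∀ {f g} k → (∀ i → i < k → f i ≡ g i) → prodℕ f k ≡ prodℕ g k
  prodℕ-cong zero    f≗g = refl
  prodℕ-cong (suc k) f≗g = cong₂ _*_ (prodℕ-cong k (λ i i<k → f≗g i (m<n⇒m<1+n i<k))) (f≗g k ≤-refl)

  prodℕ-double : ∀ f k → prodℕ (λ i → 2 * f i) k ≡ 2 ^ k * prodℕ f k
  prodℕ-double f zero    = refl
  prodℕ-double f (suc k) = trans (cong (_* (2 * f k)) (prodℕ-double f k)) (regroup (2 ^ k) (prodℕ f k) (f k))
    where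
    regroup : ∀ x y z → x * y * (2 * z) ≡ 2 * x * (y * z)
    regroup = solve-∀ ℕ-ring

  rising falling : ℕ → ℕ → ℕ
  rising  n k = prodℕ (λ i → n + i) k
  falling n k = prodℕ (λ i → n ∸ i) k

  rising-! : ∀ n k → rising (suc n) k * n ! ≡ (n + k) !
  rising-! n zero    = trans (+-identityʳ (n !)) (cong _! (sym (+-identityʳ n)))
  rising-! n (suc k) = begin
    rising (suc n) k * (suc n + k) * n !     ≡⟨ regroup (rising (suc n) k) (suc n + k) (n !) ⟩
    (suc n + k) * (rising (suc n) k * n !)   ≡⟨ cong ((suc n + k) *_) (rising-! n k) ⟩
    (suc n + k) * (n + k) !                  ≡⟨ cong _! (+-suc n k) ⟨
    (n + suc k) !                            ∎
    where
    regroup : ∀ x y z → x * y * z ≡ y * (x * z)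
    regroup = solve-∀ ℕ-ring

  falling-! : ∀ n k → falling (n + k) k * n ! ≡ (n + k) !
  falling-! n zero    = trans (+-identityʳ (n !)) (cong _! (sym (+-identityʳ n)))
  falling-! n (suc k) = begin
    falling (n + suc k) k * (n + suc k ∸ k) * n !  ≡⟨ cong (λ m → falling m k * (m ∸ k) * n !) (+-suc n k) ⟩
    falling (suc n + k) k * (suc n + k ∸ k) * n !  ≡⟨ cong (λ m → falling (suc n + k) k * m * n !) (m+n∸n≡m (suc n) k) ⟩
    falling (suc n + k) k * suc n * n !            ≡⟨ *-assoc (falling (suc n + k) k) (suc n) (n !) ⟩
    falling (suc n + k) k * suc n !                ≡⟨ falling-! (suc n) k ⟩
    (suc n + k) !                                  ≡⟨ cong _! (+-suc n k) ⟨
    (n + suc k) !                                  ∎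

  C-! : ∀ p q → ((p + q) C p) * (p ! * q !) ≡ (p + q) !
  C-! p q = begin
    ((p + q) C p) * (p ! * q !)                                  ≡⟨ cong (_* (p ! * q !)) (nCk≡n!/k![n-k]! (m≤m+n p q)) ⟩
    ((p + q) ! / (p ! * (p + q ∸ p) !)) {{p !* (p + q ∸ p) !≢0}} * (p ! * q !)
                                                               ≡⟨ cong (λ r → ((p + q) ! / (p ! * r !)) {{p !* r !≢0}} * (p ! * q !)) (m+n∸m≡n p q) ⟩
    ((p + q) ! / (p ! * q !)) {{p !* q !≢0}} * (p ! * q !)     ≡⟨ m/n*n≡m {{p !* q !≢0}} p!q!∣[p+q]! ⟩
    (p + q) !                                                  ∎
    where
    p!q!∣[p+q]! : p ! * q ! ∣ (p + q) !
    p!q!∣[p+q]! = subst (λ r → p ! * r ! ∣ (p + q) !) (m+n∸m≡n p q) (k![n∸k]!∣n! (m≤m+n p q))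

  1≤C : ∀ p q → 1 ≤ (p + q) C p
  1≤C p q with (p + q) C p | C-! p q
  ... | zero  | 0≡[p+q]! = contradiction 0≡[p+q]! (<⇒≢ (1≤n! (p + q)))
  ... | suc _ | _       = s≤s z≤n

  -- Multiplying by n! (n + 1)! n! c! turns both sides into (2n + 2a + 1)! (n + c + 3a)!.
  binomial-products : ∀ n a c →
    (((n + suc n) C n) * ((n + (c + 3 * a)) C n)) * (falling (c + 3 * a) (3 * a) * rising (suc (n + suc n)) (2 * a))
    ≡ (((n + a + suc (n + a)) C (n + a)) * ((n + a + c) C (n + a)))
      * (rising (suc n) a * rising (suc (suc n)) a * rising (suc n) a * falling (n + a + c + 2 * a) (2 * a))
  binomial-products n a c = *-cancelʳ-≡ _ _ W {{W≢0}} (trans lhs (sym rhs))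
    where
    W : ℕ
    W = n ! * suc n ! * n ! * c !
    W≢0 : NonZero W
    W≢0 = >-nonZero (*-mono-≤ (*-mono-≤ (*-mono-≤ (1≤n! n) (1≤n! (suc n))) (1≤n! n)) (1≤n! c))
    lhs : (((n + suc n) C n) * ((n + (c + 3 * a)) C n)) * (falling (c + 3 * a) (3 * a) * rising (suc (n + suc n)) (2 * a)) * W
        ≡ (n + (c + 3 * a)) ! * (n + suc n + 2 * a) !
    lhs = begin
      (C₁ * C₂) * (F * R) * W
        ≡⟨ regroup C₁ C₂ F R (n !) (suc n !) (c !) ⟩
      (C₁ * (n ! * suc n !)) * (C₂ * (n ! * (F * c !))) * R
        ≡⟨ cong₂ (λ x y → x * (C₂ * (n ! * y)) * R) (C-! n (suc n)) (falling-! c (3 * a)) ⟩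
      (n + suc n) ! * (C₂ * (n ! * (c + 3 * a) !)) * R
        ≡⟨ cong (λ x → (n + suc n) ! * x * R) (C-! n (c + 3 * a)) ⟩
      (n + suc n) ! * (n + (c + 3 * a)) ! * R
        ≡⟨ regroup′ ((n + suc n) !) ((n + (c + 3 * a)) !) R ⟩
      (n + (c + 3 * a)) ! * (R * (n + suc n) !)
        ≡⟨ cong ((n + (c + 3 * a)) ! *_) (rising-! (n + suc n) (2 * a)) ⟩
      (n + (c + 3 * a)) ! * (n + suc n + 2 * a) ! ∎
      where
      C₁ C₂ F R : ℕ
      C₁ = (n + suc n) C n
      C₂ = (n + (c + 3 * a)) C n
      F = falling (c + 3 * a) (3 * a)
      R = rising (suc (n + suc n)) (2 * a)
      regroup : ∀ C₁ C₂ F R x y z → (C₁ * C₂) * (F * R) * (x * y * x * z) ≡ (C₁ * (x * y)) * (C₂ * (x * (F * z))) * R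
      regroup = solve-∀ ℕ-ring
      regroup′ : ∀ x y z → x * y * z ≡ y * (z * x)
      regroup′ = solve-∀ ℕ-ring
    rhs : (((n + a + suc (n + a)) C (n + a)) * ((n + a + c) C (n + a)))
          * (rising (suc n) a * rising (suc (suc n)) a * rising (suc n) a * falling (n + a + c + 2 * a) (2 * a)) * W
        ≡ (n + (c + 3 * a)) ! * (n + suc n + 2 * a) !
    rhs = begin
      (C₃ * C₄) * (R₁ * R₂ * R₁ * F) * W
        ≡⟨ regroup C₃ C₄ R₁ R₂ F (n !) (suc n !) (c !) ⟩
      (C₃ * ((R₁ * n !) * (R₂ * suc n !))) * (C₄ * ((R₁ * n !) * c !)) * F
        ≡⟨ cong₂ (λ x y → (C₃ * (x * y)) * (C₄ * (x * c !)) * F) (rising-! n a) (rising-! (suc n) a) ⟩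
      (C₃ * ((n + a) ! * suc (n + a) !)) * (C₄ * ((n + a) ! * c !)) * F
        ≡⟨ cong₂ (λ x y → x * y * F) (C-! (n + a) (suc (n + a))) (C-! (n + a) c) ⟩
      (n + a + suc (n + a)) ! * (n + a + c) ! * F
        ≡⟨ regroup′ ((n + a + suc (n + a)) !) ((n + a + c) !) F ⟩
      (n + a + suc (n + a)) ! * (F * (n + a + c) !)
        ≡⟨ cong ((n + a + suc (n + a)) ! *_) (falling-! (n + a + c) (2 * a)) ⟩
      (n + a + suc (n + a)) ! * (n + a + c + 2 * a) !
        ≡⟨ cong₂ (λ x y → x ! * y !) (shift₁ n a) (shift₂ n a c) ⟩
      (n + suc n + 2 * a) ! * (n + (c + 3 * a)) !
        ≡⟨ *-comm ((n + suc n + 2 * a) !) ((n + (c + 3 * a)) !) ⟩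
      (n + (c + 3 * a)) ! * (n + suc n + 2 * a) ! ∎
      where
      C₃ C₄ R₁ R₂ F : ℕ
      C₃ = (n + a + suc (n + a)) C (n + a)
      C₄ = (n + a + c) C (n + a)
      R₁ = rising (suc n) a
      R₂ = rising (suc (suc n)) a
      F = falling (n + a + c + 2 * a) (2 * a)
      regroup : ∀ C₃ C₄ R₁ R₂ F x y z → (C₃ * C₄) * (R₁ * R₂ * R₁ * F) * (x * y * x * z)
                                        ≡ (C₃ * ((R₁ * x) * (R₂ * y))) * (C₄ * ((R₁ * x) * z)) * F
      regroup = solve-∀ ℕ-ring
      regroup′ : ∀ x y z → x * y * z ≡ x * (z * y)
      regroup′ = solve-∀ ℕ-ring
      shift₁ : ∀ n a → n + a + suc (n + a) ≡ n + suc n + 2 * a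
      shift₁ = solve-∀ ℕ-ring
      shift₂ : ∀ n a c → n + a + c + 2 * a ≡ n + (c + 3 * a)
      shift₂ = solve-∀ ℕ-ring

open Products

-- Polynomial bounds for the bracket factor

-- a³ · bracket a = numerator a / denominator a = (X/G₁) (F₂/G₂) with X/G₁ ∈ [1 - 1/a, 1] and
-- F₂/G₂ ∈ [(1 - 1/a)/2, 1/2].
module BracketPolynomials where
  open import Data.Nat
  open import Data.Nat.Properties

  X T F₂ G₁ G₂ bracketDenominator numerator denominator : ℕ → ℕ
  X a = 32 * a ^ 2 * (a ^ 2 ∸ 1) ∸ 6
  T a = 4 * a ^ 2 ∸ 3
  F₂ a = a ^ 2 * (4 * a + 1)
  G₁ a = 2 * ((4 * a ^ 2 + 2) * (4 * a ^ 2 + 1))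
  G₂ a = 2 * (T a * (a + 1))
  numerator   a = a ^ 3 * (X a * (4 * a + 1))
  bracketDenominator a = (4 * a ^ 2 + 2) * (4 * a ^ 2 + 1) * T a * (a + 1)
  denominator a = 4 * a * bracketDenominator a

  numerator≡ : ∀ a → numerator a ≡ a * (X a * F₂ a)
  numerator≡ a = identity a (X a)
    where
    identity : ∀ a x → a * (a * (a * 1)) * (x * (4 * a + 1)) ≡ a * (x * (a * (a * 1) * (4 * a + 1)))
    identity = solve-∀ ℕ-ring

  denominator≡ : ∀ a → denominator a ≡ a * (G₁ a * G₂ a)
  denominator≡ a = identity (a * (a * 1)) a (T a)
    where
    identity : ∀ q a t → 4 * a * ((4 * q + 2) * (4 * q + 1) * t * (a + 1)) ≡ a * (2 * ((4 * q + 2) * (4 * q + 1)) * (2 * (t * (a + 1))))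
    identity = solve-∀ ℕ-ring

  private
    -- Shifted to a = 2 + s the truncated subtractions disappear.
    XP : ℕ → ℕ
    XP s = 378 + s * (896 + s * (736 + s * (256 + s * 32)))

    a²∸1≡ : ∀ s → (2 + s) ^ 2 ∸ 1 ≡ 3 + s * (4 + s)
    a²∸1≡ s = m≡n+d⇒m∸d≡n {n = 3 + s * (4 + s)} 1 (identity s)
      where
      identity : ∀ s → (2 + s) * ((2 + s) * 1) ≡ 3 + s * (4 + s) + 1
      identity = solve-∀ ℕ-ring

    32a²[a²∸1]≡ : ∀ s → 32 * (2 + s) ^ 2 * ((2 + s) ^ 2 ∸ 1) ≡ XP s + 6
    32a²[a²∸1]≡ s = trans (cong (32 * (2 + s) ^ 2 *_) (a²∸1≡ s)) (expand s)
      where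
      expand : ∀ s → 32 * ((2 + s) * ((2 + s) * 1)) * (3 + s * (4 + s)) ≡ 378 + s * (896 + s * (736 + s * (256 + s * 32))) + 6
      expand = solve-∀ ℕ-ring

    X[2+s]≡ : ∀ s → X (2 + s) ≡ XP s
    X[2+s]≡ s = m≡n+d⇒m∸d≡n {n = XP s} 6 (32a²[a²∸1]≡ s)

    T[2+s]≡ : ∀ s → T (2 + s) ≡ 13 + s * (16 + s * 4)
    T[2+s]≡ s = m≡n+d⇒m∸d≡n {n = 13 + s * (16 + s * 4)} 3 (identity s)
      where
      identity : ∀ s → 4 * ((2 + s) * ((2 + s) * 1)) ≡ 13 + s * (16 + s * 4) + 3
      identity = solve-∀ ℕ-ring

  32a²[a²∸1]≥6 : ∀ a → 2 ≤ a → 6 ≤ 32 * a ^ 2 * (a ^ 2 ∸ 1)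
  32a²[a²∸1]≥6 a 2≤a with m≤n⇒∃[o]m+o≡n 2≤a
  ... | s , refl = subst (6 ≤_) (sym (32a²[a²∸1]≡ s)) (m≤n+m 6 (XP s))

  1≤T : ∀ a → 2 ≤ a → 1 ≤ T a
  1≤T a 2≤a with m≤n⇒∃[o]m+o≡n 2≤a
  ... | s , refl = subst (1 ≤_) (sym (T[2+s]≡ s)) (s≤s z≤n)

  1≤bracketDenominator : ∀ a → 2 ≤ a → 1 ≤ bracketDenominator a
  1≤bracketDenominator a 2≤a = *-mono-≤ (*-mono-≤ (*-mono-≤ (≤-trans (s≤s z≤n) (m≤n+m 2 (4 * a ^ 2)))
    (m≤n+m 1 (4 * a ^ 2))) (1≤T a 2≤a)) (m≤n+m 1 a)

  1≤denominator : ∀ a → 2 ≤ a → 1 ≤ denominator a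
  1≤denominator a 2≤a = *-mono-≤ (*-mono-≤ {1} {4} (s≤s z≤n) (≤-trans (s≤s z≤n) 2≤a)) (1≤bracketDenominator a 2≤a)

  X≤G₁ : ∀ a → 2 ≤ a → X a ≤ G₁ a
  X≤G₁ a 2≤a with m≤n⇒∃[o]m+o≡n 2≤a
  ... | s , refl = subst (_≤ G₁ (2 + s)) (sym (X[2+s]≡ s))
    (≤-byRemainder {XP s} {G₁ (2 + s)} (234 + s * (224 + s * 56)) (identity s))
    where
    identity : ∀ s → 378 + s * (896 + s * (736 + s * (256 + s * 32))) + (234 + s * (224 + s * 56))
      ≡ 2 * ((4 * ((2 + s) * ((2 + s) * 1)) + 2) * (4 * ((2 + s) * ((2 + s) * 1)) + 1))
    identity = solve-∀ ℕ-ring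

  [a∸1]G₁≤aX : ∀ a → 2 ≤ a → (a ∸ 1) * G₁ a ≤ a * X a
  [a∸1]G₁≤aX a 2≤a with m≤n⇒∃[o]m+o≡n 2≤a
  ... | s , refl = subst ((1 + s) * G₁ (2 + s) ≤_) (cong ((2 + s) *_) (sym (X[2+s]≡ s)))
    (≤-byRemainder {(1 + s) * G₁ (2 + s)} {(2 + s) * XP s} (144 + s * (438 + s * (456 + s * (200 + s * 32)))) (identity s))
    where
    identity : ∀ s → (1 + s) * (2 * ((4 * ((2 + s) * ((2 + s) * 1)) + 2) * (4 * ((2 + s) * ((2 + s) * 1)) + 1)))
        + (144 + s * (438 + s * (456 + s * (200 + s * 32))))
      ≡ (2 + s) * (378 + s * (896 + s * (736 + s * (256 + s * 32))))
    identity = solve-∀ ℕ-ring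

  2F₂≤G₂ : ∀ a → 2 ≤ a → 2 * F₂ a ≤ G₂ a
  2F₂≤G₂ a 2≤a with m≤n⇒∃[o]m+o≡n 2≤a
  ... | s , refl = subst (2 * F₂ (2 + s) ≤_) (cong (λ t → 2 * (t * (2 + s + 1))) (sym (T[2+s]≡ s)))
    (≤-byRemainder {2 * F₂ (2 + s)} (6 + s * (18 + s * 6)) (identity s))
    where
    identity : ∀ s → 2 * ((2 + s) * ((2 + s) * 1) * (4 * (2 + s) + 1)) + (6 + s * (18 + s * 6))
      ≡ 2 * ((13 + s * (16 + s * 4)) * (2 + s + 1))
    identity = solve-∀ ℕ-ring

  [a∸1]G₂≤2aF₂ : ∀ a → 2 ≤ a → (a ∸ 1) * G₂ a ≤ 2 * a * F₂ a
  [a∸1]G₂≤2aF₂ a 2≤a with m≤n⇒∃[o]m+o≡n 2≤a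
  ... | s , refl = subst (λ t → (1 + s) * (2 * (t * (2 + s + 1))) ≤ 2 * (2 + s) * F₂ (2 + s)) (sym (T[2+s]≡ s))
    (≤-byRemainder {(1 + s) * (2 * ((13 + s * (16 + s * 4)) * (2 + s + 1)))} {2 * (2 + s) * F₂ (2 + s)}
      (66 + s * (80 + s * (26 + s * 2))) (identity s))
    where
    identity : ∀ s → (1 + s) * (2 * ((13 + s * (16 + s * 4)) * (2 + s + 1))) + (66 + s * (80 + s * (26 + s * 2)))
      ≡ 2 * (2 + s) * ((2 + s) * ((2 + s) * 1) * (4 * (2 + s) + 1))
    identity = solve-∀ ℕ-ring

  numerator*2≤denominator : ∀ a → 2 ≤ a → numerator a * 2 ≤ 1 * denominator a
  numerator*2≤denominator a 2≤a = begin
    numerator a * 2              ≡⟨ cong (_* 2) (numerator≡ a) ⟩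
    a * (X a * F₂ a) * 2         ≡⟨ regroup a (X a) (F₂ a) ⟩
    a * (X a * (2 * F₂ a))       ≤⟨ *-monoʳ-≤ a (*-mono-≤ (X≤G₁ a 2≤a) (2F₂≤G₂ a 2≤a)) ⟩
    a * (G₁ a * G₂ a)            ≡⟨ denominator≡ a ⟨
    denominator a                ≡⟨ *-identityˡ (denominator a) ⟨
    1 * denominator a            ∎
    where
    open ≤-Reasoning
    regroup : ∀ a x f → a * (x * f) * 2 ≡ a * (x * (2 * f))
    regroup = solve-∀ ℕ-ring

  [a∸2]*denominator≤numerator*2a : ∀ a → 2 ≤ a → (a ∸ 2) * denominator a ≤ numerator a * (2 * a)
  [a∸2]*denominator≤numerator*2a a 2≤a = begin
    (a ∸ 2) * denominator a                        ≡⟨ cong ((a ∸ 2) *_) (denominator≡ a) ⟩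
    (a ∸ 2) * (a * (G₁ a * G₂ a))                  ≡⟨ *-assoc (a ∸ 2) a (G₁ a * G₂ a) ⟨
    (a ∸ 2) * a * (G₁ a * G₂ a)                    ≤⟨ *-monoˡ-≤ (G₁ a * G₂ a) [a∸2]a≤[a∸1]² ⟩
    (a ∸ 1) * (a ∸ 1) * (G₁ a * G₂ a)              ≡⟨ regroup (a ∸ 1) (G₁ a) (G₂ a) ⟩
    ((a ∸ 1) * G₁ a) * ((a ∸ 1) * G₂ a)            ≤⟨ *-mono-≤ ([a∸1]G₁≤aX a 2≤a) ([a∸1]G₂≤2aF₂ a 2≤a) ⟩
    (a * X a) * (2 * a * F₂ a)                     ≡⟨ regroup′ a (X a) (F₂ a) ⟩
    a * (X a * F₂ a) * (2 * a)                     ≡⟨ cong (_* (2 * a)) (numerator≡ a) ⟨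
    numerator a * (2 * a)                          ∎
    where
    open ≤-Reasoning
    [a∸2]a≤[a∸1]² : (a ∸ 2) * a ≤ (a ∸ 1) * (a ∸ 1)
    [a∸2]a≤[a∸1]² with m≤n⇒∃[o]m+o≡n 2≤a
    ... | s , refl = ≤-byRemainder 1 (identity s)
      where
      identity : ∀ s → s * (2 + s) + 1 ≡ (1 + s) * (1 + s)
      identity = solve-∀ ℕ-ring
    regroup : ∀ b g h → b * b * (g * h) ≡ (b * g) * (b * h)
    regroup = solve-∀ ℕ-ring
    regroup′ : ∀ a x f → (a * x) * (2 * a * f) ≡ a * (x * f) * (2 * a)
    regroup′ = solve-∀ ℕ-ring

open BracketPolynomials
  using (numerator; denominator; bracketDenominator; 32a²[a²∸1]≥6; 1≤bracketDenominator; 1≤denominator;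
         numerator*2≤denominator; [a∸2]*denominator≤numerator*2a)

-- The schedule of steps for a given a

-- The factors (K ± j)/K, K = 8a², are read along two walks of positions that both end at
-- 12a² + 20a: walk A starts at 0 and takes K + 2i, K + 2 + 2i, K + 2i (i < a), then K - 8 - 2i
-- (i < 3a); walk B starts at K + 12a and takes K + i, then K - 5 - i (i < 2a).
module Schedule (a : ℕ) (5≤a : 5 ≤ℕ a) where
  open import Data.Nat
  open import Data.Nat.Properties
  open import Data.Nat.Combinatorics using (_C_)
  open ≡-Reasoning

  K : ℕ
  K = 8 * a ^ 2

  Σ : ℕ → ℕ → ℕ → ℕ
  Σ c d k = sumℕ (progression c d) k

  lengthA lengthB endB : ℕ
  lengthA = 0 + Σ 0 2 a + Σ 2 2 a + Σ 0 2 a + Σ 8 2 (3 * a)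
  lengthB = 0 + Σ 0 1 (2 * a) + Σ 5 1 (2 * a)
  endB = K + 12 * a + Σ 0 1 (2 * a) + Σ 5 1 (2 * a)

  lengthA≡ : lengthA ≡ 12 * a * a + 20 * a
  lengthA≡ = *-cancelˡ-≡ lengthA _ 2 (+-cancelʳ-≡ (12 * a) _ _ (begin
    2 * lengthA + 12 * a
      ≡⟨ regroup (Σ 0 2 a) (Σ 2 2 a) (Σ 8 2 (3 * a)) a ⟩
    (2 * Σ 0 2 a + 2 * a) + (2 * Σ 2 2 a + 2 * a) + (2 * Σ 0 2 a + 2 * a) + (2 * Σ 8 2 (3 * a) + 2 * (3 * a))
      ≡⟨ cong₂ (λ x y → x + y + x + (2 * Σ 8 2 (3 * a) + 2 * (3 * a)))
               (sumℕ-progression 0 2 a) (sumℕ-progression 2 2 a) ⟩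
    a * (2 * 0 + 2 * a) + a * (2 * 2 + 2 * a) + a * (2 * 0 + 2 * a) + (2 * Σ 8 2 (3 * a) + 2 * (3 * a))
      ≡⟨ cong (a * (2 * 0 + 2 * a) + a * (2 * 2 + 2 * a) + a * (2 * 0 + 2 * a) +_) (sumℕ-progression 8 2 (3 * a)) ⟩
    a * (2 * 0 + 2 * a) + a * (2 * 2 + 2 * a) + a * (2 * 0 + 2 * a) + 3 * a * (2 * 8 + 2 * (3 * a))
      ≡⟨ expand a ⟩
    2 * (12 * a * a + 20 * a) + 12 * a ∎))
    where
    regroup : ∀ x y z a → 2 * (0 + x + y + x + z) + 12 * a
      ≡ (2 * x + 2 * a) + (2 * y + 2 * a) + (2 * x + 2 * a) + (2 * z + 2 * (3 * a))
    regroup = solve-∀ ℕ-ring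
    expand : ∀ a → a * (2 * 0 + 2 * a) + a * (2 * 2 + 2 * a) + a * (2 * 0 + 2 * a) + 3 * a * (2 * 8 + 2 * (3 * a))
      ≡ 2 * (12 * a * a + 20 * a) + 12 * a
    expand = solve-∀ ℕ-ring

  lengthB≡ : lengthB ≡ 4 * a * a + 8 * a
  lengthB≡ = *-cancelˡ-≡ lengthB _ 2 (+-cancelʳ-≡ (4 * a) _ _ (begin
    2 * lengthB + 4 * a
      ≡⟨ regroup (Σ 0 1 (2 * a)) (Σ 5 1 (2 * a)) a ⟩
    (2 * Σ 0 1 (2 * a) + 1 * (2 * a)) + (2 * Σ 5 1 (2 * a) + 1 * (2 * a))
      ≡⟨ cong₂ _+_ (sumℕ-progression 0 1 (2 * a)) (sumℕ-progression 5 1 (2 * a)) ⟩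
    2 * a * (2 * 0 + 1 * (2 * a)) + 2 * a * (2 * 5 + 1 * (2 * a))
      ≡⟨ expand a ⟩
    2 * (4 * a * a + 8 * a) + 4 * a ∎))
    where
    regroup : ∀ x y a → 2 * (0 + x + y) + 4 * a ≡ (2 * x + 1 * (2 * a)) + (2 * y + 1 * (2 * a))
    regroup = solve-∀ ℕ-ring
    expand : ∀ a → 2 * a * (2 * 0 + 1 * (2 * a)) + 2 * a * (2 * 5 + 1 * (2 * a)) ≡ 2 * (4 * a * a + 8 * a) + 4 * a
    expand = solve-∀ ℕ-ring

  endB≡lengthA : endB ≡ lengthA
  endB≡lengthA = begin
    K + 12 * a + Σ 0 1 (2 * a) + Σ 5 1 (2 * a)  ≡⟨ regroup (a ^ 2) a (Σ 0 1 (2 * a)) (Σ 5 1 (2 * a)) ⟩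
    8 * a ^ 2 + 12 * a + lengthB                   ≡⟨ cong (8 * a ^ 2 + 12 * a +_) lengthB≡ ⟩
    8 * a ^ 2 + 12 * a + (4 * a * a + 8 * a)  ≡⟨ expand a ⟩
    12 * a * a + 20 * a                       ≡⟨ lengthA≡ ⟨
    lengthA                                        ∎
    where
    regroup : ∀ q a x y → 8 * q + 12 * a + x + y ≡ 8 * q + 12 * a + (0 + x + y)
    regroup = solve-∀ ℕ-ring
    expand : ∀ a → 8 * (a * (a * 1)) + 12 * a + (4 * a * a + 8 * a) ≡ 12 * a * a + 20 * a
    expand = solve-∀ ℕ-ring

  lengthA≤2K : lengthA ≤ 2 * K
  lengthA≤2K = subst (_≤ 2 * K) (sym lengthA≡)
    (≤-byShift 5 (λ a → 12 * a * a + 20 * a) (λ a → 2 * (8 * a ^ 2)) (λ s → 20 * s + 4 * s * s) identity 5≤a)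
    where
    identity : ∀ s → 12 * (5 + s) * (5 + s) + 20 * (5 + s) + (20 * s + 4 * s * s) ≡ 2 * (8 * ((5 + s) * ((5 + s) * 1)))
    identity = solve-∀ ℕ-ring

  lengthA+lengthB≤3K : lengthA + lengthB ≤ 3 * K
  lengthA+lengthB≤3K = subst (_≤ 3 * K) (sym (cong₂ _+_ lengthA≡ lengthB≡))
    (≤-byShift 5 (λ a → 12 * a * a + 20 * a + (4 * a * a + 8 * a)) (λ a → 3 * (8 * a ^ 2))
      (λ s → 60 + 52 * s + 8 * s * s) identity 5≤a)
    where
    identity : ∀ s → 12 * (5 + s) * (5 + s) + 20 * (5 + s) + (4 * (5 + s) * (5 + s) + 8 * (5 + s)) + (60 + 52 * s + 8 * s * s)
      ≡ 3 * (8 * ((5 + s) * ((5 + s) * 1)))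
    identity = solve-∀ ℕ-ring

  12a*a≤2K : 12 * a * a ≤ 2 * K
  12a*a≤2K = subst (12 * a * a ≤_) (identity a) (m≤m+n (12 * a * a) (4 * a * a))
    where
    identity : ∀ a → 12 * a * a + 4 * a * a ≡ 2 * (8 * (a * (a * 1)))
    identity = solve-∀ ℕ-ring

  steps≤ : ∀ c d k → c + d * k ≤ 8 * a → ∀ i → i < k → progression c d i * a ≤ K
  steps≤ c d k last≤8a i i<k = ≤-trans (*-monoˡ-≤ a (≤-trans (+-monoʳ-≤ c (*-monoʳ-≤ d (<⇒≤ i<k))) last≤8a))
    (≤-reflexive (identity a))
    where
    identity : ∀ a → 8 * a * a ≡ 8 * (a * (a * 1))
    identity = solve-∀ ℕ-ring

  private
    shifted : ∀ (L R Q : ℕ → ℕ) → (∀ s → L (5 + s) + Q s ≡ R (5 + s)) → L a ≤ R a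
    shifted L R Q identity = ≤-byShift 5 L R Q identity 5≤a

  -- The largest step of each block is at most 8a, so every step is at most K/a.
  0+2a≤8a : 0 + 2 * a ≤ 8 * a
  0+2a≤8a = ≤-byRemainder (6 * a) (identity a)
    where
    identity : ∀ a → 0 + 2 * a + 6 * a ≡ 8 * a
    identity = solve-∀ ℕ-ring

  2+2a≤8a : 2 + 2 * a ≤ 8 * a
  2+2a≤8a = shifted (λ a → 2 + 2 * a) (8 *_) (λ s → 28 + 6 * s) identity
    where
    identity : ∀ s → 2 + 2 * (5 + s) + (28 + 6 * s) ≡ 8 * (5 + s)
    identity = solve-∀ ℕ-ring

  8+2[3a]≤8a : 8 + 2 * (3 * a) ≤ 8 * a
  8+2[3a]≤8a = shifted (λ a → 8 + 2 * (3 * a)) (8 *_) (λ s → 2 + 2 * s) identity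
    where
    identity : ∀ s → 8 + 2 * (3 * (5 + s)) + (2 + 2 * s) ≡ 8 * (5 + s)
    identity = solve-∀ ℕ-ring

  5+[2a]≤8a : 5 + 1 * (2 * a) ≤ 8 * a
  5+[2a]≤8a = shifted (λ a → 5 + 1 * (2 * a)) (8 *_) (λ s → 25 + 6 * s) identity
    where
    identity : ∀ s → 5 + 1 * (2 * (5 + s)) + (25 + 6 * s) ≡ 8 * (5 + s)
    identity = solve-∀ ℕ-ring

  0+[2a]≤8a : 0 + 1 * (2 * a) ≤ 8 * a
  0+[2a]≤8a = ≤-byRemainder (6 * a) (identity a)
    where
    identity : ∀ a → 0 + 1 * (2 * a) + 6 * a ≡ 8 * a
    identity = solve-∀ ℕ-ring

  1≤K : 1 ≤ K
  1≤K = shifted (λ _ → 1) (λ a → 8 * a ^ 2) (λ s → 199 + 80 * s + 8 * s * s) identity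
    where
    identity : ∀ s → 1 + (199 + 80 * s + 8 * s * s) ≡ 8 * ((5 + s) * ((5 + s) * 1))
    identity = solve-∀ ℕ-ring

  -- n = 4a² - 1 and c = n - 3a - 3 are the parameters of binomial-products.
  c n : ℕ
  c = 4 * a ^ 2 ∸ (3 * a + 4)
  n = c + 3 * a + 3

  4a²≡c+3a+4 : 4 * a ^ 2 ≡ c + (3 * a + 4)
  4a²≡c+3a+4 = sym (m∸n+n≡m (shifted (λ a → 3 * a + 4) (λ a → 4 * a ^ 2) (λ s → 81 + 37 * s + 4 * s * s) identity))
    where
    identity : ∀ s → 3 * (5 + s) + 4 + (81 + 37 * s + 4 * s * s) ≡ 4 * ((5 + s) * ((5 + s) * 1))
    identity = solve-∀ ℕ-ring

  K≡2[c+3a+4] : K ≡ 2 * (c + (3 * a + 4))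
  K≡2[c+3a+4] = trans (*-assoc 2 4 (a ^ 2)) (cong (2 *_) 4a²≡c+3a+4)

  8a²∸1≡ : 8 * a ^ 2 ∸ 1 ≡ n + suc n
  8a²∸1≡ = m≡n+d⇒m∸d≡n 1 (trans K≡2[c+3a+4] (identity c a))
    where
    identity : ∀ c a → 2 * (c + (3 * a + 4)) ≡ c + 3 * a + 3 + suc (c + 3 * a + 3) + 1
    identity = solve-∀ ℕ-ring

  4a²∸1≡ : 4 * a ^ 2 ∸ 1 ≡ n
  4a²∸1≡ = m≡n+d⇒m∸d≡n 1 (trans 4a²≡c+3a+4 (identity c a))
    where
    identity : ∀ c a → c + (3 * a + 4) ≡ c + 3 * a + 3 + 1
    identity = solve-∀ ℕ-ring

  8a²∸5≡ : 8 * a ^ 2 ∸ 5 ≡ n + (c + 3 * a)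
  8a²∸5≡ = m≡n+d⇒m∸d≡n 5 (trans K≡2[c+3a+4] (identity c a))
    where
    identity : ∀ c a → 2 * (c + (3 * a + 4)) ≡ c + 3 * a + 3 + (c + 3 * a) + 5
    identity = solve-∀ ℕ-ring

  8a²+2a∸1≡ : 8 * a ^ 2 + 2 * a ∸ 1 ≡ n + a + suc (n + a)
  8a²+2a∸1≡ = m≡n+d⇒m∸d≡n 1 (trans (cong (_+ 2 * a) K≡2[c+3a+4]) (identity c a))
    where
    identity : ∀ c a → 2 * (c + (3 * a + 4)) + 2 * a ≡ c + 3 * a + 3 + a + suc (c + 3 * a + 3 + a) + 1
    identity = solve-∀ ℕ-ring

  4a²+a∸1≡ : 4 * a ^ 2 + a ∸ 1 ≡ n + a
  4a²+a∸1≡ = m≡n+d⇒m∸d≡n 1 (trans (cong (_+ a) 4a²≡c+3a+4) (identity c a))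
    where
    identity : ∀ c a → c + (3 * a + 4) + a ≡ c + 3 * a + 3 + a + 1
    identity = solve-∀ ℕ-ring

  8a²∸2a∸5≡ : 8 * a ^ 2 ∸ 2 * a ∸ 5 ≡ n + a + c
  8a²∸2a∸5≡ = m≡n+d⇒m∸d≡n 5 (m≡n+d⇒m∸d≡n (2 * a) (trans K≡2[c+3a+4] (identity c a)))
    where
    identity : ∀ c a → 2 * (c + (3 * a + 4)) ≡ c + 3 * a + 3 + a + c + 5 + 2 * a
    identity = solve-∀ ℕ-ring

  P₁ P₂ P₃ P₄ P₅ : ℕ
  P₁ = prodℕ (λ i → K + progression 0 2 i) a
  P₂ = prodℕ (λ i → K + progression 2 2 i) a
  P₃ = prodℕ (λ i → K ∸ progression 8 2 i) (3 * a)
  P₄ = prodℕ (λ i → K ∸ progression 5 1 i) (2 * a)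
  P₅ = prodℕ (λ i → K + progression 0 1 i) (2 * a)

  P₁≡ : P₁ ≡ 2 ^ a * rising (suc n) a
  P₁≡ = trans (prodℕ-cong a (λ i _ → trans (cong (_+ 2 * i) K≡2[c+3a+4]) (identity c a i)))
              (prodℕ-double (λ i → suc n + i) a)
    where
    identity : ∀ c a i → 2 * (c + (3 * a + 4)) + 2 * i ≡ 2 * (suc (c + 3 * a + 3) + i)
    identity = solve-∀ ℕ-ring

  P₂≡ : P₂ ≡ 2 ^ a * rising (suc (suc n)) a
  P₂≡ = trans (prodℕ-cong a (λ i _ → trans (cong (_+ (2 + 2 * i)) K≡2[c+3a+4]) (identity c a i)))
              (prodℕ-double (λ i → suc (suc n) + i) a)
    where
    identity : ∀ c a i → 2 * (c + (3 * a + 4)) + (2 + 2 * i) ≡ 2 * (suc (suc (c + 3 * a + 3)) + i)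
    identity = solve-∀ ℕ-ring

  P₃≡ : P₃ ≡ 2 ^ (3 * a) * falling (c + 3 * a) (3 * a)
  P₃≡ = trans (prodℕ-cong (3 * a) (λ i _ → begin
      K ∸ (8 + 2 * i)                          ≡⟨ cong (_∸ (8 + 2 * i)) (trans K≡2[c+3a+4] (identity c a)) ⟩
      (8 + 2 * (c + 3 * a)) ∸ (8 + 2 * i)      ≡⟨ [m+n]∸[m+o]≡n∸o 8 (2 * (c + 3 * a)) (2 * i) ⟩
      2 * (c + 3 * a) ∸ 2 * i                  ≡⟨ *-distribˡ-∸ 2 (c + 3 * a) i ⟨
      2 * (c + 3 * a ∸ i)                      ∎))
    (prodℕ-double (λ i → c + 3 * a ∸ i) (3 * a))
    where
    identity : ∀ c a → 2 * (c + (3 * a + 4)) ≡ 8 + 2 * (c + 3 * a)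
    identity = solve-∀ ℕ-ring

  P₄≡ : P₄ ≡ falling (n + a + c + 2 * a) (2 * a)
  P₄≡ = prodℕ-cong (2 * a) (λ i _ → begin
    K ∸ (5 + 1 * i)                        ≡⟨ cong (_∸ (5 + 1 * i)) (trans K≡2[c+3a+4] (identity c a)) ⟩
    (5 + (n + a + c + 2 * a)) ∸ (5 + 1 * i) ≡⟨ [m+n]∸[m+o]≡n∸o 5 (n + a + c + 2 * a) (1 * i) ⟩
    n + a + c + 2 * a ∸ 1 * i              ≡⟨ cong (n + a + c + 2 * a ∸_) (*-identityˡ i) ⟩
    n + a + c + 2 * a ∸ i                  ∎)
    where
    identity : ∀ c a → 2 * (c + (3 * a + 4)) ≡ 5 + (c + 3 * a + 3 + a + c + 2 * a)
    identity = solve-∀ ℕ-ring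

  P₅≡ : P₅ ≡ rising (suc (n + suc n)) (2 * a)
  P₅≡ = prodℕ-cong (2 * a) (λ i _ → trans (cong₂ _+_ K≡2[c+3a+4] (*-identityˡ i)) (cong (_+ i) (identity c a)))
    where
    identity : ∀ c a → 2 * (c + (3 * a + 4)) ≡ suc (c + 3 * a + 3 + suc (c + 3 * a + 3))
    identity = solve-∀ ℕ-ring

  C₁ C₂ C₃ C₄ : ℕ
  C₁ = (8 * a ^ 2 ∸ 1) C (4 * a ^ 2 ∸ 1)
  C₂ = (8 * a ^ 2 ∸ 5) C (4 * a ^ 2 ∸ 1)
  C₃ = (8 * a ^ 2 + 2 * a ∸ 1) C (4 * a ^ 2 + a ∸ 1)
  C₄ = (8 * a ^ 2 ∸ 2 * a ∸ 5) C (4 * a ^ 2 + a ∸ 1)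

  1≤C₃*C₄ : 1 ≤ C₃ * C₄
  1≤C₃*C₄ = *-mono-≤ (subst (1 ≤_) (sym (cong₂ _C_ 8a²+2a∸1≡ 4a²+a∸1≡)) (1≤C (n + a) (suc (n + a))))
                     (subst (1 ≤_) (sym (cong₂ _C_ 8a²∸2a∸5≡ 4a²+a∸1≡)) (1≤C (n + a) c))

  binomial-identity : (C₁ * C₂) * (P₃ * P₅) ≡ (C₃ * C₄) * (P₁ * P₂ * P₁ * P₄)
  binomial-identity = begin
    (C₁ * C₂) * (P₃ * P₅)
      ≡⟨ cong₂ _*_ (cong₂ _*_ (cong₂ _C_ 8a²∸1≡ 4a²∸1≡) (cong₂ _C_ 8a²∸5≡ 4a²∸1≡))
                                (cong₂ _*_ (trans P₃≡ (cong (_* F₃) 2^3a≡)) P₅≡) ⟩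
    (C₁′ * C₂′) * ((2 ^ a * (2 ^ a * 2 ^ a)) * F₃ * R₅)
      ≡⟨ regroup (2 ^ a) (C₁′ * C₂′) F₃ R₅ ⟩
    2 ^ a * (2 ^ a * 2 ^ a) * ((C₁′ * C₂′) * (F₃ * R₅))
      ≡⟨ cong (2 ^ a * (2 ^ a * 2 ^ a) *_) (binomial-products n a c) ⟩
    2 ^ a * (2 ^ a * 2 ^ a) * ((C₃′ * C₄′) * (R₁ * R₂ * R₁ * F₄))
      ≡⟨ regroup′ (2 ^ a) (C₃′ * C₄′) R₁ R₂ F₄ ⟩
    (C₃′ * C₄′) * ((2 ^ a * R₁) * (2 ^ a * R₂) * (2 ^ a * R₁) * F₄)
      ≡⟨ cong₂ _*_ (cong₂ _*_ (cong₂ _C_ 8a²+2a∸1≡ 4a²+a∸1≡) (cong₂ _C_ 8a²∸2a∸5≡ 4a²+a∸1≡))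
                                (cong₂ (λ x y → x * y * x * F₄) P₁≡ P₂≡) ⟨
    (C₃ * C₄) * (P₁ * P₂ * P₁ * F₄)
      ≡⟨ cong (λ x → (C₃ * C₄) * (P₁ * P₂ * P₁ * x)) P₄≡ ⟨
    (C₃ * C₄) * (P₁ * P₂ * P₁ * P₄) ∎
    where
    C₁′ C₂′ C₃′ C₄′ F₃ R₅ R₁ R₂ F₄ : ℕ
    C₁′ = (n + suc n) C n
    C₂′ = (n + (c + 3 * a)) C n
    C₃′ = (n + a + suc (n + a)) C (n + a)
    C₄′ = (n + a + c) C (n + a)
    F₃ = falling (c + 3 * a) (3 * a)
    R₅ = rising (suc (n + suc n)) (2 * a)
    R₁ = rising (suc n) a
    R₂ = rising (suc (suc n)) a
    F₄ = falling (n + a + c + 2 * a) (2 * a)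
    2^3a≡ : 2 ^ (3 * a) ≡ 2 ^ a * (2 ^ a * 2 ^ a)
    2^3a≡ = trans (^-distribˡ-+-* 2 a (2 * a))
      (cong (2 ^ a *_) (trans (^-distribˡ-+-* 2 a (1 * a)) (cong (λ m → 2 ^ a * 2 ^ m) (*-identityˡ a))))
    regroup : ∀ t C F R → C * (t * (t * t) * F * R) ≡ t * (t * t) * (C * (F * R))
    regroup = solve-∀ ℕ-ring
    regroup′ : ∀ t C R₁ R₂ F → t * (t * t) * (C * (R₁ * R₂ * R₁ * F)) ≡ C * ((t * R₁) * (t * R₂) * (t * R₁) * F)
    regroup′ = solve-∀ ℕ-ring

-- Imported only now, so that the modules above can use ℕ's + and * unqualified.
open import Data.Integer as ℤ using (ℤ; +_; +[1+_]; -[1+_]; 1ℤ)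
import Data.Integer.Properties as ℤₚ
open import Data.Rational
  using (ℚ; mkℚ; 0ℚ; 1ℚ; ½; _+_; _*_; _-_; -_; _≤_; _<_; ∣_∣; *≤*; *<*; toℚᵘ; _/_; nonNegative; positive; +-*-rawSemiring)
open import Data.Rational.Properties
import Data.Rational.Unnormalised as ℚᵘ
import Data.Rational.Unnormalised.Properties as ℚᵘₚ
open import Algebra.Definitions.RawSemiring +-*-rawSemiring using () renaming (_^_ to _^ℚ_)
open import Data.Sum using (inj₁; inj₂)
open import Relation.Nullary.Decidable.Core using (dec⇒maybe; yes; no)
open import Tactic.RingSolver.Core.AlmostCommutativeRing
  using (AlmostCommutativeRing; fromCommutativeRing)
open import Data.Integer.Tactic.RingSolver using () renaming (ring to ℤ-ring)

ℚ-ring : AlmostCommutativeRing _ _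
ℚ-ring = fromCommutativeRing +-*-commutativeRing (λ q → dec⇒maybe (0ℚ ≟ q))

private variable
  p q r s t u x : ℚ

0≤1 : 0ℚ ≤ 1ℚ
0≤1 = *≤* (ℤ.+≤+ ℕ.z≤n)

0≤½ : 0ℚ ≤ ½
0≤½ = *≤* (ℤ.+≤+ ℕ.z≤n)

0<1 : 0ℚ < 1ℚ
0<1 = *<* (ℤ.+<+ (ℕ.s≤s ℕ.z≤n))

0<½ : 0ℚ < ½
0<½ = *<* (ℤ.+<+ (ℕ.s≤s ℕ.z≤n))

*-pos : 0ℚ < p → 0ℚ < q → 0ℚ < p * q
*-pos {p} {q} 0<p 0<q = positive⁻¹ (p * q) {{pos*pos⇒pos p {{positive 0<p}} q {{positive 0<q}}}}

+-nonNeg : 0ℚ ≤ p → 0ℚ ≤ q → 0ℚ ≤ p + q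
+-nonNeg 0≤p 0≤q = +-mono-≤ 0≤p 0≤q

*-nonNeg : 0ℚ ≤ p → 0ℚ ≤ q → 0ℚ ≤ p * q
*-nonNeg {p} {q} 0≤p 0≤q =
  nonNegative⁻¹ (p * q) {{nonNeg*nonNeg⇒nonNeg p {{nonNegative 0≤p}} q {{nonNegative 0≤q}}}}

p≤q⇒0≤q-p : p ≤ q → 0ℚ ≤ q - p
p≤q⇒0≤q-p {p} {q} p≤q = subst (_≤ q - p) (+-inverseʳ p) (+-monoˡ-≤ (- p) p≤q)

≤-byDifference : q - p ≡ r → 0ℚ ≤ r → p ≤ q
≤-byDifference {q} {p} q-p≡r 0≤r =
  subst₂ _≤_ (+-identityˡ p) (shift q p) (+-monoˡ-≤ p (subst (0ℚ ≤_) (sym q-p≡r) 0≤r))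
  where
  shift : ∀ q p → (q - p) + p ≡ q
  shift = solve-∀ ℚ-ring

p≤p+q : 0ℚ ≤ q → p ≤ p + q
p≤p+q {q} {p} 0≤q = ≤-byDifference (identity p q) 0≤q
  where
  identity : ∀ p q → (p + q) - p ≡ q
  identity = solve-∀ ℚ-ring

*-monoʳ-≤-nonNeg′ : 0ℚ ≤ r → p ≤ q → p * r ≤ q * r
*-monoʳ-≤-nonNeg′ {r} 0≤r = *-monoʳ-≤-nonNeg r {{nonNegative 0≤r}}

*-monoˡ-≤-nonNeg′ : 0ℚ ≤ r → p ≤ q → r * p ≤ r * q
*-monoˡ-≤-nonNeg′ {r} 0≤r = *-monoˡ-≤-nonNeg r {{nonNegative 0≤r}}

*-mono-≤-nonNeg : 0ℚ ≤ p → 0ℚ ≤ r → p ≤ q → r ≤ s → p * r ≤ q * s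
*-mono-≤-nonNeg 0≤p 0≤r p≤q r≤s =
  ≤-trans (*-monoʳ-≤-nonNeg′ 0≤r p≤q) (*-monoˡ-≤-nonNeg′ (≤-trans 0≤p p≤q) r≤s)

private
  toℚᵘ-ℕ→ℚ : ∀ n → toℚᵘ (ℕ→ℚ n) ℚᵘ.≃ ℚᵘ.mkℚᵘ (+ n) 0
  toℚᵘ-ℕ→ℚ n = toℚᵘ-fromℚᵘ (ℚᵘ.mkℚᵘ (+ n) 0)

  ℕ→ℚ-homo : ∀ (_∙_ : ℚ → ℚ → ℚ) (_∙ᵘ_ : ℚᵘ.ℚᵘ → ℚᵘ.ℚᵘ → ℚᵘ.ℚᵘ) (_∙ℕ_ : ℕ → ℕ → ℕ) →
    (∀ p q → toℚᵘ (p ∙ q) ℚᵘ.≃ toℚᵘ p ∙ᵘ toℚᵘ q) →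
    (∀ {p p′ q q′} → p ℚᵘ.≃ p′ → q ℚᵘ.≃ q′ → p ∙ᵘ q ℚᵘ.≃ p′ ∙ᵘ q′) →
    (∀ m n → ℚᵘ.mkℚᵘ (+ m) 0 ∙ᵘ ℚᵘ.mkℚᵘ (+ n) 0 ℚᵘ.≃ ℚᵘ.mkℚᵘ (+ (m ∙ℕ n)) 0) →
    ∀ m n → ℕ→ℚ (m ∙ℕ n) ≡ ℕ→ℚ m ∙ ℕ→ℚ n
  ℕ→ℚ-homo _∙_ _∙ᵘ_ _∙ℕ_ homo ∙ᵘ-cong on-literals m n = toℚᵘ-injective (begin
    toℚᵘ (ℕ→ℚ (m ∙ℕ n))                     ≈⟨ toℚᵘ-ℕ→ℚ (m ∙ℕ n) ⟩
    ℚᵘ.mkℚᵘ (+ (m ∙ℕ n)) 0                  ≈⟨ on-literals m n ⟨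
    ℚᵘ.mkℚᵘ (+ m) 0 ∙ᵘ ℚᵘ.mkℚᵘ (+ n) 0       ≈⟨ ∙ᵘ-cong (toℚᵘ-ℕ→ℚ m) (toℚᵘ-ℕ→ℚ n) ⟨
    toℚᵘ (ℕ→ℚ m) ∙ᵘ toℚᵘ (ℕ→ℚ n)            ≈⟨ homo (ℕ→ℚ m) (ℕ→ℚ n) ⟨
    toℚᵘ (ℕ→ℚ m ∙ ℕ→ℚ n)                    ∎)
    where open ℚᵘₚ.≃-Reasoning

ℕ→ℚ-+ : ∀ m n → ℕ→ℚ (m ℕ.+ n) ≡ ℕ→ℚ m + ℕ→ℚ n
ℕ→ℚ-+ = ℕ→ℚ-homo _+_ ℚᵘ._+_ ℕ._+_ toℚᵘ-homo-+ ℚᵘₚ.+-cong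
  (λ m n → ℚᵘ.*≡* (trans (identity (+ m) (+ n)) (cong (ℤ._* (1ℤ ℤ.* 1ℤ)) (sym (ℤₚ.pos-+ m n)))))
  where
  identity : ∀ m n → (m ℤ.* 1ℤ ℤ.+ n ℤ.* 1ℤ) ℤ.* 1ℤ ≡ (m ℤ.+ n) ℤ.* (1ℤ ℤ.* 1ℤ)
  identity = solve-∀ ℤ-ring

ℕ→ℚ-* : ∀ m n → ℕ→ℚ (m ℕ.* n) ≡ ℕ→ℚ m * ℕ→ℚ n
ℕ→ℚ-* = ℕ→ℚ-homo _*_ ℚᵘ._*_ ℕ._*_ toℚᵘ-homo-* ℚᵘₚ.*-cong
  (λ m n → ℚᵘ.*≡* (trans (identity (+ m) (+ n)) (cong (ℤ._* (1ℤ ℤ.* 1ℤ)) (sym (ℤₚ.pos-* m n)))))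
  where
  identity : ∀ m n → m ℤ.* n ℤ.* 1ℤ ≡ (m ℤ.* n) ℤ.* (1ℤ ℤ.* 1ℤ)
  identity = solve-∀ ℤ-ring

0≤ℕ→ℚ : ∀ n → 0ℚ ≤ ℕ→ℚ n
0≤ℕ→ℚ n = nonNegative⁻¹ (ℕ→ℚ n) {{normalize-nonNeg n 1}}

ℕ→ℚ-mono-≤ : ∀ {m n} → m ≤ℕ n → ℕ→ℚ m ≤ ℕ→ℚ n
ℕ→ℚ-mono-≤ {m} m≤n with ℕₚ.m≤n⇒∃[o]m+o≡n m≤n
... | o , refl = subst (ℕ→ℚ m ≤_) (sym (ℕ→ℚ-+ m o))
  (subst (_≤ ℕ→ℚ m + ℕ→ℚ o) (+-identityʳ (ℕ→ℚ m)) (+-monoʳ-≤ (ℕ→ℚ m) (0≤ℕ→ℚ o)))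

recip : ℕ → ℚ
recip n = 1ℚ ÷ℕ n

÷ℕ≡*recip : ∀ q n → q ÷ℕ n ≡ q * recip n
÷ℕ≡*recip q zero    = sym (*-zeroʳ q)
÷ℕ≡*recip q (suc n) = cong (q *_) (sym (*-identityˡ (+ 1 / suc n)))

0≤recip : ∀ n → 0ℚ ≤ recip n
0≤recip zero    = ≤-refl
0≤recip (suc n) = subst (0ℚ ≤_) (sym (*-identityˡ (+ 1 / suc n))) (nonNegative⁻¹ (+ 1 / suc n) {{normalize-nonNeg 1 (suc n)}})

ℕ→ℚ*recip≡1 : ∀ {n} → 1 ≤ℕ n → ℕ→ℚ n * recip n ≡ 1ℚ
ℕ→ℚ*recip≡1 {suc n} _ = trans (cong (ℕ→ℚ (suc n) *_) (*-identityˡ (+ 1 / suc n))) (toℚᵘ-injective (begin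
  toℚᵘ (ℕ→ℚ (suc n) * (+ 1 / suc n))                 ≈⟨ toℚᵘ-homo-* (ℕ→ℚ (suc n)) (+ 1 / suc n) ⟩
  toℚᵘ (ℕ→ℚ (suc n)) ℚᵘ.* toℚᵘ (+ 1 / suc n)         ≈⟨ ℚᵘₚ.*-cong (toℚᵘ-fromℚᵘ (ℚᵘ.mkℚᵘ (+ suc n) 0))
                                                                     (toℚᵘ-fromℚᵘ (ℚᵘ.mkℚᵘ (+ 1) n)) ⟩
  ℚᵘ.mkℚᵘ (+ suc n) 0 ℚᵘ.* ℚᵘ.mkℚᵘ (+ 1) n             ≈⟨ ℚᵘ.*≡* (cong +[1+_] (identity n)) ⟩
  ℚᵘ.mkℚᵘ (+ 1) 0                                    ≈⟨ toℚᵘ-fromℚᵘ (ℚᵘ.mkℚᵘ (+ 1) 0) ⟨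
  toℚᵘ 1ℚ                                            ∎))
  where
  open ℚᵘₚ.≃-Reasoning
  identity : ∀ n → n ℕ.* 1 ℕ.* 1 ≡ n ℕ.+ 0 ℕ.* suc n ℕ.+ 0 ℕ.* suc (n ℕ.+ 0 ℕ.* suc n)
  identity = solve-∀ ℕ-ring

*ℕ→ℚ≡⇒≡÷ℕ : ∀ {n} → 1 ≤ℕ n → p * ℕ→ℚ n ≡ q → p ≡ q ÷ℕ n
*ℕ→ℚ≡⇒≡÷ℕ {p} {q} {n} 1≤n pn≡q = begin
  p                        ≡⟨ *-identityʳ p ⟨
  p * 1ℚ                   ≡⟨ cong (p *_) (ℕ→ℚ*recip≡1 1≤n) ⟨
  p * (ℕ→ℚ n * recip n)    ≡⟨ *-assoc p (ℕ→ℚ n) (recip n) ⟨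
  p * ℕ→ℚ n * recip n      ≡⟨ cong (_* recip n) pn≡q ⟩
  q * recip n              ≡⟨ ÷ℕ≡*recip q n ⟨
  q ÷ℕ n                   ∎
  where open ≡-Reasoning

recip-* : ∀ {m n} → 1 ≤ℕ m → 1 ≤ℕ n → recip (m ℕ.* n) ≡ recip m * recip n
recip-* {m} {n} 1≤m 1≤n = sym (*ℕ→ℚ≡⇒≡÷ℕ (ℕₚ.*-mono-≤ 1≤m 1≤n) (begin
  recip m * recip n * ℕ→ℚ (m ℕ.* n)             ≡⟨ cong (recip m * recip n *_) (ℕ→ℚ-* m n) ⟩
  recip m * recip n * (ℕ→ℚ m * ℕ→ℚ n)           ≡⟨ regroup (recip m) (recip n) (ℕ→ℚ m) (ℕ→ℚ n) ⟩
  (ℕ→ℚ m * recip m) * (ℕ→ℚ n * recip n)         ≡⟨ cong₂ _*_ (ℕ→ℚ*recip≡1 1≤m) (ℕ→ℚ*recip≡1 1≤n) ⟩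
  1ℚ                                            ∎))
  where
  open ≡-Reasoning
  regroup : ∀ r s m n → r * s * (m * n) ≡ (m * r) * (n * s)
  regroup = solve-∀ ℚ-ring

0≤÷ℕ : ∀ n → 0ℚ ≤ p → 0ℚ ≤ p ÷ℕ n
0≤÷ℕ {p} n 0≤p = subst (0ℚ ≤_) (sym (÷ℕ≡*recip p n)) (*-nonNeg 0≤p (0≤recip n))

÷ℕ-monoˡ-≤ : ∀ n → p ≤ q → p ÷ℕ n ≤ q ÷ℕ n
÷ℕ-monoˡ-≤ {p} {q} n p≤q =
  subst₂ _≤_ (sym (÷ℕ≡*recip p n)) (sym (÷ℕ≡*recip q n)) (*-monoʳ-≤-nonNeg′ (0≤recip n) p≤q)

fraction-≤ : ∀ {u v m n} → 1 ≤ℕ m → 1 ≤ℕ n → u ℕ.* n ≤ℕ v ℕ.* m → ℕ→ℚ u ÷ℕ m ≤ ℕ→ℚ v ÷ℕ n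
fraction-≤ {u} {v} {m} {n} 1≤m 1≤n un≤vm = begin
  ℕ→ℚ u ÷ℕ m                                        ≡⟨ ÷ℕ≡*recip (ℕ→ℚ u) m ⟩
  ℕ→ℚ u * recip m                                   ≡⟨ *-identityʳ _ ⟨
  ℕ→ℚ u * recip m * 1ℚ                              ≡⟨ cong (ℕ→ℚ u * recip m *_) (ℕ→ℚ*recip≡1 1≤n) ⟨
  ℕ→ℚ u * recip m * (ℕ→ℚ n * recip n)               ≡⟨ regroup (ℕ→ℚ u) (recip m) (ℕ→ℚ n) (recip n) ⟩
  ℕ→ℚ u * ℕ→ℚ n * (recip m * recip n)               ≤⟨ *-monoʳ-≤-nonNeg′ (*-nonNeg (0≤recip m) (0≤recip n))
                                                          (subst₂ _≤_ (ℕ→ℚ-* u n) (ℕ→ℚ-* v m) (ℕ→ℚ-mono-≤ un≤vm)) ⟩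
  ℕ→ℚ v * ℕ→ℚ m * (recip m * recip n)               ≡⟨ regroup′ (ℕ→ℚ v) (ℕ→ℚ m) (recip m) (recip n) ⟩
  ℕ→ℚ v * recip n * (ℕ→ℚ m * recip m)               ≡⟨ cong (ℕ→ℚ v * recip n *_) (ℕ→ℚ*recip≡1 1≤m) ⟩
  ℕ→ℚ v * recip n * 1ℚ                              ≡⟨ *-identityʳ _ ⟩
  ℕ→ℚ v * recip n                                   ≡⟨ ÷ℕ≡*recip (ℕ→ℚ v) n ⟨
  ℕ→ℚ v ÷ℕ n                                        ∎
  where
  open ≤-Reasoning
  regroup : ∀ u r n s → u * r * (n * s) ≡ u * n * (r * s)
  regroup = solve-∀ ℚ-ring
  regroup′ : ∀ v m r s → v * m * (r * s) ≡ v * s * (m * r)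
  regroup′ = solve-∀ ℚ-ring

-- Agreement of nonnegative rationals up to a relative error

infix 4 _≈[_]_

record _≈[_]_ (p t q : ℚ) : Set where
  field
    0≤error           : 0ℚ ≤ t
    0≤left            : 0ℚ ≤ p
    0≤right           : 0ℚ ≤ q
    shrunk-left≤right : (1ℚ - t) * p ≤ q
    shrunk-right≤left : (1ℚ - t) * q ≤ p

open _≈[_]_

≈-cong : ∀ {p′ t′ q′} → p ≡ p′ → t ≡ t′ → q ≡ q′ → p ≈[ t ] q → p′ ≈[ t′ ] q′
≈-cong refl refl refl p≈q = p≈q

≈-refl : 0ℚ ≤ p → p ≈[ 0ℚ ] p
≈-refl {p} 0≤p = record
  { 0≤error = ≤-refl ; 0≤left = 0≤p ; 0≤right = 0≤p
  ; shrunk-left≤right = ≤-reflexive (*-identityˡ p)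
  ; shrunk-right≤left = ≤-reflexive (*-identityˡ p) }

≈-sym : p ≈[ t ] q → q ≈[ t ] p
≈-sym p≈q = record
  { 0≤error = 0≤error p≈q ; 0≤left = 0≤right p≈q ; 0≤right = 0≤left p≈q
  ; shrunk-left≤right = shrunk-right≤left p≈q
  ; shrunk-right≤left = shrunk-left≤right p≈q }

private
  shrink-≤ : 0ℚ ≤ t → 0ℚ ≤ p → (1ℚ - t) * p ≤ p
  shrink-≤ {t} {p} 0≤t 0≤p = ≤-byDifference (identity t p) (*-nonNeg 0≤t 0≤p)
    where
    identity : ∀ t p → p - (1ℚ - t) * p ≡ t * p
    identity = solve-∀ ℚ-ring

  shrink-antimono : t ≤ u → 0ℚ ≤ p → (1ℚ - u) * p ≤ (1ℚ - t) * p
  shrink-antimono {t} {u} {p} t≤u 0≤p = ≤-byDifference (identity t u p) (*-nonNeg (p≤q⇒0≤q-p t≤u) 0≤p)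
    where
    identity : ∀ t u p → (1ℚ - t) * p - (1ℚ - u) * p ≡ (u - t) * p
    identity = solve-∀ ℚ-ring

  -- If u > 1 the shrunk bound is negative and the claim is trivial.
  shrink-chain : 0ℚ ≤ t → 0ℚ ≤ u → 0ℚ ≤ p → 0ℚ ≤ r →
    (1ℚ - t) * p ≤ q → (1ℚ - u) * q ≤ r → (1ℚ - (t + u)) * p ≤ r
  shrink-chain {t} {u} {p} {r} {q} 0≤t 0≤u 0≤p 0≤r tp≤q uq≤r with u ≤? 1ℚ
  ... | yes u≤1 = begin
    (1ℚ - (t + u)) * p        ≤⟨ ≤-byDifference (identity t u p) (*-nonNeg (*-nonNeg 0≤t 0≤u) 0≤p) ⟩
    (1ℚ - u) * ((1ℚ - t) * p) ≤⟨ *-monoˡ-≤-nonNeg′ (p≤q⇒0≤q-p u≤1) tp≤q ⟩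
    (1ℚ - u) * q              ≤⟨ uq≤r ⟩
    r                         ∎
    where
    open ≤-Reasoning
    identity : ∀ t u p → (1ℚ - u) * ((1ℚ - t) * p) - (1ℚ - (t + u)) * p ≡ t * u * p
    identity = solve-∀ ℚ-ring
  ... | no u≰1 = ≤-trans (≤-byDifference (identity t u p) (*-nonNeg 0≤t+u-1 0≤p)) 0≤r
    where
    identity : ∀ t u p → 0ℚ - (1ℚ - (t + u)) * p ≡ (t + (u - 1ℚ)) * p
    identity = solve-∀ ℚ-ring
    0≤t+u-1 : 0ℚ ≤ t + (u - 1ℚ)
    0≤t+u-1 = +-nonNeg 0≤t (p≤q⇒0≤q-p (<⇒≤ (≰⇒> u≰1)))

≈-trans : p ≈[ t ] q → q ≈[ u ] r → p ≈[ t + u ] r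
≈-trans {t = t} {u = u} p≈q q≈r = record
  { 0≤error = +-nonNeg (0≤error p≈q) (0≤error q≈r)
  ; 0≤left = 0≤left p≈q ; 0≤right = 0≤right q≈r
  ; shrunk-left≤right = shrink-chain (0≤error p≈q) (0≤error q≈r) (0≤left p≈q) (0≤right q≈r)
      (shrunk-left≤right p≈q) (shrunk-left≤right q≈r)
  ; shrunk-right≤left = subst (λ e → (1ℚ - e) * _ ≤ _) (+-comm u t)
      (shrink-chain (0≤error q≈r) (0≤error p≈q) (0≤right q≈r) (0≤left p≈q)
        (shrunk-right≤left q≈r) (shrunk-right≤left p≈q)) }

≈-weaken : t ≤ u → p ≈[ t ] q → p ≈[ u ] q
≈-weaken t≤u p≈q = record
  { 0≤error = ≤-trans (0≤error p≈q) t≤u ; 0≤left = 0≤left p≈q ; 0≤right = 0≤right p≈q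
  ; shrunk-left≤right = ≤-trans (shrink-antimono t≤u (0≤left p≈q)) (shrunk-left≤right p≈q)
  ; shrunk-right≤left = ≤-trans (shrink-antimono t≤u (0≤right p≈q)) (shrunk-right≤left p≈q) }

≈-*ˡ : 0ℚ ≤ r → p ≈[ t ] q → r * p ≈[ t ] r * q
≈-*ˡ {r} {p} {t} {q} 0≤r p≈q = record
  { 0≤error = 0≤error p≈q ; 0≤left = *-nonNeg 0≤r (0≤left p≈q) ; 0≤right = *-nonNeg 0≤r (0≤right p≈q)
  ; shrunk-left≤right = subst (_≤ r * q) (swap r t p) (*-monoˡ-≤-nonNeg′ 0≤r (shrunk-left≤right p≈q))
  ; shrunk-right≤left = subst (_≤ r * p) (swap r t q) (*-monoˡ-≤-nonNeg′ 0≤r (shrunk-right≤left p≈q)) }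
  where
  swap : ∀ r t p → r * ((1ℚ - t) * p) ≡ (1ℚ - t) * (r * p)
  swap = solve-∀ ℚ-ring

≈-* : ∀ {p′ q′} → p ≈[ t ] q → p′ ≈[ u ] q′ → p * p′ ≈[ t + u ] q * q′
≈-* {p} {t} {q} {u} {p′} {q′} p≈q p′≈q′ =
  ≈-trans (≈-cong (*-comm p′ p) refl (*-comm p′ q) (≈-*ˡ (0≤left p′≈q′) p≈q)) (≈-*ˡ (0≤right p≈q) p′≈q′)

≈-splice : ∀ {F G F′ G′ A B C} → 0ℚ ≤ G → 0ℚ ≤ G′ →
  F * A ≈[ t ] G * B → F′ * C ≈[ u ] G′ * B → (F * G′) * A ≈[ t + u ] (G * F′) * C
≈-splice {t} {u} {F} {G} {F′} {G′} {A} {B} {C} 0≤G 0≤G′ FA≈GB F′C≈G′B = ≈-trans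
  (≈-cong (regroup G′ F A) refl (regroup′ G′ G B) (≈-*ˡ 0≤G′ FA≈GB))
  (≈-cong refl refl (sym (*-assoc G F′ C)) (≈-*ˡ 0≤G (≈-sym F′C≈G′B)))
  where
  regroup : ∀ x y z → x * (y * z) ≡ (y * x) * z
  regroup = solve-∀ ℚ-ring
  regroup′ : ∀ x y z → x * (y * z) ≡ y * (x * z)
  regroup′ = solve-∀ ℚ-ring

≈-cancelˡ : 0ℚ < r → r * p ≈[ t ] r * q → p ≈[ t ] q
≈-cancelˡ {r} {p} {t} {q} 0<r rp≈rq = record
  { 0≤error = 0≤error rp≈rq
  ; 0≤left = cancel (subst (_≤ r * p) (sym (*-zeroʳ r)) (0≤left rp≈rq))
  ; 0≤right = cancel (subst (_≤ r * q) (sym (*-zeroʳ r)) (0≤right rp≈rq))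
  ; shrunk-left≤right = cancel (subst (_≤ r * q) (swap t r p) (shrunk-left≤right rp≈rq))
  ; shrunk-right≤left = cancel (subst (_≤ r * p) (swap t r q) (shrunk-right≤left rp≈rq)) }
  where
  cancel : ∀ {a b} → r * a ≤ r * b → a ≤ b
  cancel = *-cancelˡ-≤-pos r {{positive 0<r}}
  swap : ∀ t r p → (1ℚ - t) * (r * p) ≡ r * ((1ℚ - t) * p)
  swap = solve-∀ ℚ-ring

≈-fromBounds : 0ℚ ≤ t → 0ℚ ≤ p → (1ℚ - t) * q ≤ p → p ≤ q → p ≈[ t ] q
≈-fromBounds 0≤t 0≤p tq≤p p≤q = record
  { 0≤error = 0≤t ; 0≤left = 0≤p ; 0≤right = ≤-trans 0≤p p≤q
  ; shrunk-left≤right = ≤-trans (shrink-≤ 0≤t 0≤p) p≤q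
  ; shrunk-right≤left = tq≤p }

private
  ∣∣≤ : p ≤ q → - p ≤ q → ∣ p ∣ ≤ q
  ∣∣≤ {p} p≤q -p≤q with ∣p∣≡p∨∣p∣≡-p p
  ... | inj₁ ∣p∣≡p  = subst (_≤ _) (sym ∣p∣≡p) p≤q
  ... | inj₂ ∣p∣≡-p = subst (_≤ _) (sym ∣p∣≡-p) -p≤q

-- t ≤ ½ is what bounds p by 2q.
≈⇒∣-∣≤ : t ≤ ½ → q ≤ r → p ≈[ t ] q → ∣ p - q ∣ ≤ (r + r) * t
≈⇒∣-∣≤ {t} {q} {r} {p} t≤½ q≤r p≈q = ∣∣≤
  (≤-byDifference (identity₁ p q r t)
    (+-nonNeg 0≤A (*-nonNeg 0≤t (+-nonNeg (+-nonNeg (+-nonNeg (+-nonNeg (+-nonNeg 0≤r-q 0≤r-q) 0≤A) 0≤A) 0≤p/2) 0≤p/2))))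
  (≤-byDifference (identity₂ p q r t)
    (+-nonNeg (p≤q⇒0≤q-p (shrunk-right≤left p≈q)) (*-nonNeg 0≤t (+-nonNeg 0≤r-q (≤-trans (0≤right p≈q) q≤r)))))
  where
  0≤t : 0ℚ ≤ t
  0≤t = 0≤error p≈q
  0≤A : 0ℚ ≤ q - (1ℚ - t) * p
  0≤A = p≤q⇒0≤q-p (shrunk-left≤right p≈q)
  0≤r-q : 0ℚ ≤ r - q
  0≤r-q = p≤q⇒0≤q-p q≤r
  0≤p/2 : 0ℚ ≤ (½ - t) * p
  0≤p/2 = *-nonNeg (p≤q⇒0≤q-p t≤½) (0≤left p≈q)
  identity₁ : ∀ p q r t → (r + r) * t - (p - q)
    ≡ (q - (1ℚ - t) * p) + t * ((r - q) + (r - q) + (q - (1ℚ - t) * p) + (q - (1ℚ - t) * p) + (½ - t) * p + (½ - t) * p)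
  identity₁ = solve-∀ ℚ-ring
  identity₂ : ∀ p q r t → (r + r) * t - - (p - q) ≡ (p - (1ℚ - t) * q) + t * ((r - q) + r)
  identity₂ = solve-∀ ℚ-ring

-- Partial sums of the exponential series

^ℚ-nonNeg : ∀ n → 0ℚ ≤ s → 0ℚ ≤ s ^ℚ n
^ℚ-nonNeg zero    0≤s = *≤* (ℤ.+≤+ ℕ.z≤n)
^ℚ-nonNeg (suc n) 0≤s = *-nonNeg 0≤s (^ℚ-nonNeg n 0≤s)

^ℚ-mono-≤ : ∀ n → 0ℚ ≤ s → s ≤ t → s ^ℚ n ≤ t ^ℚ n
^ℚ-mono-≤ zero    0≤s s≤t = ≤-refl
^ℚ-mono-≤ (suc n) 0≤s s≤t = *-mono-≤-nonNeg 0≤s (^ℚ-nonNeg n 0≤s) s≤t (^ℚ-mono-≤ n 0≤s s≤t)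

1^ℚn≡1 : ∀ n → 1ℚ ^ℚ n ≡ 1ℚ
1^ℚn≡1 zero    = refl
1^ℚn≡1 (suc n) = trans (*-identityˡ (1ℚ ^ℚ n)) (1^ℚn≡1 n)

ℕ→ℚ-^ : ∀ m n → ℕ→ℚ m ^ℚ n ≡ ℕ→ℚ (m ^ n)
ℕ→ℚ-^ m zero    = refl
ℕ→ℚ-^ m (suc n) = trans (cong (ℕ→ℚ m *_) (ℕ→ℚ-^ m n)) (sym (ℕ→ℚ-* m (m ^ n)))

^ℚ-+ : ∀ m n → p ^ℚ (m ℕ.+ n) ≡ p ^ℚ m * p ^ℚ n
^ℚ-+ {p} zero    n = sym (*-identityˡ (p ^ℚ n))
^ℚ-+ {p} (suc m) n = trans (cong (p *_) (^ℚ-+ m n)) (sym (*-assoc p (p ^ℚ m) (p ^ℚ n)))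

private
  ℕ→ℚ-suc : ∀ n → ℕ→ℚ (suc n) ≡ 1ℚ + ℕ→ℚ n
  ℕ→ℚ-suc = ℕ→ℚ-+ 1

^ℚ-increment-≤ : ∀ n → 0ℚ ≤ s → 0ℚ ≤ x →
  (s + x) ^ℚ suc n - s ^ℚ suc n ≤ ℕ→ℚ (suc n) * x * (s + x) ^ℚ n
^ℚ-increment-≤ {s} {x} zero    0≤s 0≤x = ≤-reflexive (identity s x)
  where
  identity : ∀ s x → (s + x) * 1ℚ - s * 1ℚ ≡ 1ℚ * x * 1ℚ
  identity = solve-∀ ℚ-ring
^ℚ-increment-≤ {s} {x} (suc n) 0≤s 0≤x = begin
  (s + x) * P - s * S                          ≡⟨ split s x P S ⟩
  (s + x) * (P - S) + x * S                    ≤⟨ +-mono-≤ (*-monoˡ-≤-nonNeg′ (+-nonNeg 0≤s 0≤x) (^ℚ-increment-≤ n 0≤s 0≤x))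
                                                           (*-monoˡ-≤-nonNeg′ 0≤x (^ℚ-mono-≤ (suc n) 0≤s (p≤p+q 0≤x))) ⟩
  (s + x) * (ℕ→ℚ (suc n) * x * T) + x * P      ≡⟨ merge s x T (ℕ→ℚ (suc n)) ⟩
  (1ℚ + ℕ→ℚ (suc n)) * x * ((s + x) * T)       ≡⟨ cong (λ c → c * x * P) (ℕ→ℚ-suc (suc n)) ⟨
  ℕ→ℚ (suc (suc n)) * x * P                    ∎
  where
  open ≤-Reasoning
  P S T : ℚ
  P = (s + x) ^ℚ suc n
  S = s ^ℚ suc n
  T = (s + x) ^ℚ n
  split : ∀ s x P S → (s + x) * P - s * S ≡ (s + x) * (P - S) + x * S
  split = solve-∀ ℚ-ring
  merge : ∀ s x T c → (s + x) * (c * x * T) + x * ((s + x) * T) ≡ (1ℚ + c) * x * ((s + x) * T)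
  merge = solve-∀ ℚ-ring

^ℚ-increment-≥ : ∀ n → 0ℚ ≤ s → 0ℚ ≤ x →
  ℕ→ℚ (suc n) * x * s ^ℚ n ≤ (s + x) ^ℚ suc n - s ^ℚ suc n
^ℚ-increment-≥ {s} {x} zero    0≤s 0≤x = ≤-reflexive (identity s x)
  where
  identity : ∀ s x → 1ℚ * x * 1ℚ ≡ (s + x) * 1ℚ - s * 1ℚ
  identity = solve-∀ ℚ-ring
^ℚ-increment-≥ {s} {x} (suc n) 0≤s 0≤x = begin
  ℕ→ℚ (suc (suc n)) * x * S                    ≡⟨ cong (λ c → c * x * S) (ℕ→ℚ-suc (suc n)) ⟩
  (1ℚ + ℕ→ℚ (suc n)) * x * (s * U)             ≡⟨ split s x U (ℕ→ℚ (suc n)) ⟩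
  s * (ℕ→ℚ (suc n) * x * U) + x * (s * U)      ≤⟨ +-mono-≤ (*-monoˡ-≤-nonNeg′ 0≤s (^ℚ-increment-≥ n 0≤s 0≤x))
                                                           (*-monoˡ-≤-nonNeg′ 0≤x (^ℚ-mono-≤ (suc n) 0≤s (p≤p+q 0≤x))) ⟩
  s * (P - S) + x * P                          ≡⟨ merge s x P S ⟩
  (s + x) * P - s * S                          ∎
  where
  open ≤-Reasoning
  P S U : ℚ
  P = (s + x) ^ℚ suc n
  S = s ^ℚ suc n
  U = s ^ℚ n
  split : ∀ s x U c → (1ℚ + c) * x * (s * U) ≡ s * (c * x * U) + x * (s * U)
  split = solve-∀ ℚ-ring
  merge : ∀ s x P S → s * (P - S) + x * P ≡ (s + x) * P - s * S
  merge = solve-∀ ℚ-ring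

expSum : ℕ → ℚ → ℚ
expSum zero    s = 0ℚ
expSum (suc n) s = expSum n s + s ^ℚ n ÷ℕ n !

eSum≡expSum : ∀ m → eSum m ≡ expSum (suc m) 1ℚ
eSum≡expSum zero    = refl
eSum≡expSum (suc m) = cong₂ _+_ (eSum≡expSum m) (cong (_÷ℕ suc m !) (sym (1^ℚn≡1 (suc m))))

expSum-nonNeg : ∀ n → 0ℚ ≤ s → 0ℚ ≤ expSum n s
expSum-nonNeg zero    0≤s = ≤-refl
expSum-nonNeg (suc n) 0≤s = +-nonNeg (expSum-nonNeg n 0≤s) (0≤÷ℕ (n !) (^ℚ-nonNeg n 0≤s))

expSum-≤-suc : ∀ n → 0ℚ ≤ s → expSum n s ≤ expSum (suc n) s
expSum-≤-suc n 0≤s = p≤p+q (0≤÷ℕ (n !) (^ℚ-nonNeg n 0≤s))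

1≤expSum : ∀ n → 0ℚ ≤ s → 1ℚ ≤ expSum (suc n) s
1≤expSum zero    0≤s = ≤-refl
1≤expSum (suc n) 0≤s = ≤-trans (1≤expSum n 0≤s) (expSum-≤-suc (suc n) 0≤s)

expSum-at-0 : ∀ n → expSum (suc n) 0ℚ ≡ 1ℚ
expSum-at-0 zero    = refl
expSum-at-0 (suc n) = begin
  expSum (suc n) 0ℚ + 0ℚ * 0ℚ ^ℚ n ÷ℕ suc n !     ≡⟨ cong₂ _+_ (expSum-at-0 n) (÷ℕ≡*recip (0ℚ * 0ℚ ^ℚ n) (suc n !)) ⟩
  1ℚ + 0ℚ * 0ℚ ^ℚ n * recip (suc n !)           ≡⟨ identity (0ℚ ^ℚ n) (recip (suc n !)) ⟩
  1ℚ                                           ∎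
  where
  open ≡-Reasoning
  identity : ∀ p r → 1ℚ + 0ℚ * p * r ≡ 1ℚ
  identity = solve-∀ ℚ-ring

private
  suc*recip[suc!]≡recip! : ∀ n → ℕ→ℚ (suc n) * recip (suc n !) ≡ recip (n !)
  suc*recip[suc!]≡recip! n = begin
    ℕ→ℚ (suc n) * recip (suc n ℕ.* n !)          ≡⟨ cong (ℕ→ℚ (suc n) *_) (recip-* {suc n} (ℕ.s≤s ℕ.z≤n) (ℕₚ.1≤n! n)) ⟩
    ℕ→ℚ (suc n) * (recip (suc n) * recip (n !))  ≡⟨ *-assoc (ℕ→ℚ (suc n)) (recip (suc n)) (recip (n !)) ⟨
    ℕ→ℚ (suc n) * recip (suc n) * recip (n !)    ≡⟨ cong (_* recip (n !)) (ℕ→ℚ*recip≡1 {suc n} (ℕ.s≤s ℕ.z≤n)) ⟩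
    1ℚ * recip (n !)                             ≡⟨ *-identityˡ (recip (n !)) ⟩
    recip (n !)                                  ∎
    where open ≡-Reasoning

  expSum-suc-difference : ∀ n y z → expSum (suc (suc n)) z - expSum (suc (suc n)) y
    ≡ (expSum (suc n) z - expSum (suc n) y) + (z ^ℚ suc n - y ^ℚ suc n) * recip (suc n !)
  expSum-suc-difference n y z = begin
    (expSum (suc n) z + z ^ℚ suc n ÷ℕ suc n !) - (expSum (suc n) y + y ^ℚ suc n ÷ℕ suc n !)
      ≡⟨ cong₂ (λ u v → (expSum (suc n) z + u) - (expSum (suc n) y + v))
               (÷ℕ≡*recip (z ^ℚ suc n) (suc n !)) (÷ℕ≡*recip (y ^ℚ suc n) (suc n !)) ⟩
    (expSum (suc n) z + z ^ℚ suc n * c) - (expSum (suc n) y + y ^ℚ suc n * c)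
      ≡⟨ identity (expSum (suc n) z) (expSum (suc n) y) (z ^ℚ suc n) (y ^ℚ suc n) c ⟩
    (expSum (suc n) z - expSum (suc n) y) + (z ^ℚ suc n - y ^ℚ suc n) * c ∎
    where
    open ≡-Reasoning
    c : ℚ
    c = recip (suc n !)
    identity : ∀ a b c d r → (a + c * r) - (b + d * r) ≡ (a - b) + (c - d) * r
    identity = solve-∀ ℚ-ring

  absorb-term : ∀ n x E y → x * E + ℕ→ℚ (suc n) * x * y ^ℚ n * recip (suc n !) ≡ x * (E + y ^ℚ n ÷ℕ n !)
  absorb-term n x E y = begin
    x * E + ℕ→ℚ (suc n) * x * Y * recip (suc n !)     ≡⟨ identity x E Y (ℕ→ℚ (suc n)) (recip (suc n !)) ⟩
    x * (E + Y * (ℕ→ℚ (suc n) * recip (suc n !)))     ≡⟨ cong (λ r → x * (E + Y * r)) (suc*recip[suc!]≡recip! n) ⟩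
    x * (E + Y * recip (n !))                         ≡⟨ cong (λ v → x * (E + v)) (÷ℕ≡*recip Y (n !)) ⟨
    x * (E + Y ÷ℕ n !)                                ∎
    where
    open ≡-Reasoning
    Y : ℚ
    Y = y ^ℚ n
    identity : ∀ x E Y c r → x * E + c * x * Y * r ≡ x * (E + Y * (c * r))
    identity = solve-∀ ℚ-ring

-- Mean value bounds: the derivative of expSum (suc n) is expSum n.
expSum-increment-≤ : ∀ n → 0ℚ ≤ s → 0ℚ ≤ x → expSum (suc n) (s + x) - expSum (suc n) s ≤ x * expSum n (s + x)
expSum-increment-≤ {s} {x} zero    0≤s 0≤x = ≤-reflexive (identity (expSum 1 s) x)
  where
  identity : ∀ c x → c - c ≡ x * 0ℚ
  identity = solve-∀ ℚ-ring
expSum-increment-≤ {s} {x} (suc n) 0≤s 0≤x = begin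
  expSum (suc (suc n)) (s + x) - expSum (suc (suc n)) s
    ≡⟨ expSum-suc-difference n s (s + x) ⟩
  (expSum (suc n) (s + x) - expSum (suc n) s) + ((s + x) ^ℚ suc n - s ^ℚ suc n) * recip (suc n !)
    ≤⟨ +-mono-≤ (expSum-increment-≤ n 0≤s 0≤x) (*-monoʳ-≤-nonNeg′ (0≤recip (suc n !)) (^ℚ-increment-≤ n 0≤s 0≤x)) ⟩
  x * expSum n (s + x) + ℕ→ℚ (suc n) * x * (s + x) ^ℚ n * recip (suc n !)
    ≡⟨ absorb-term n x (expSum n (s + x)) (s + x) ⟩
  x * expSum (suc n) (s + x) ∎
  where open ≤-Reasoning

expSum-increment-≥ : ∀ n → 0ℚ ≤ s → 0ℚ ≤ x → x * expSum n s ≤ expSum (suc n) (s + x) - expSum (suc n) s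
expSum-increment-≥ {s} {x} zero    0≤s 0≤x = ≤-reflexive (identity (expSum 1 s) x)
  where
  identity : ∀ c x → x * 0ℚ ≡ c - c
  identity = solve-∀ ℚ-ring
expSum-increment-≥ {s} {x} (suc n) 0≤s 0≤x = begin
  x * expSum (suc n) s
    ≡⟨ absorb-term n x (expSum n s) s ⟨
  x * expSum n s + ℕ→ℚ (suc n) * x * s ^ℚ n * recip (suc n !)
    ≤⟨ +-mono-≤ (expSum-increment-≥ n 0≤s 0≤x) (*-monoʳ-≤-nonNeg′ (0≤recip (suc n !)) (^ℚ-increment-≥ n 0≤s 0≤x)) ⟩
  (expSum (suc n) (s + x) - expSum (suc n) s) + ((s + x) ^ℚ suc n - s ^ℚ suc n) * recip (suc n !)
    ≡⟨ expSum-suc-difference n s (s + x) ⟨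
  expSum (suc (suc n)) (s + x) - expSum (suc (suc n)) s ∎
  where open ≤-Reasoning

expSum-mono-≤ : ∀ n → 0ℚ ≤ s → 0ℚ ≤ x → expSum (suc n) s ≤ expSum (suc n) (s + x)
expSum-mono-≤ n 0≤s 0≤x = ≤-byDifference refl
  (≤-trans (*-nonNeg 0≤x (expSum-nonNeg n 0≤s)) (expSum-increment-≥ n 0≤s 0≤x))

expSum-shift-upper : ∀ n → 0ℚ ≤ s → 0ℚ ≤ x → (1ℚ - x) * expSum (suc n) (s + x) ≤ expSum (suc n) s
expSum-shift-upper {s} {x} n 0≤s 0≤x = ≤-byDifference (identity A B (expSum n (s + x)) x)
  (+-nonNeg (*-nonNeg 0≤x (p≤q⇒0≤q-p (expSum-≤-suc n 0≤s+x))) (p≤q⇒0≤q-p (expSum-increment-≤ n 0≤s 0≤x)))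
  where
  A B : ℚ
  A = expSum (suc n) s
  B = expSum (suc n) (s + x)
  0≤s+x : 0ℚ ≤ s + x
  0≤s+x = +-nonNeg 0≤s 0≤x
  identity : ∀ A B E x → A - (1ℚ - x) * B ≡ x * (B - E) + (x * E - (B - A))
  identity = solve-∀ ℚ-ring

-- The last term of expSum (suc n) at s = 2; it bounds the last term on all of [0, 2].
δ : ℕ → ℚ
δ n = ℕ→ℚ (2 ^ n) ÷ℕ n !

0≤δ : ∀ n → 0ℚ ≤ δ n
0≤δ n = 0≤÷ℕ (n !) (0≤ℕ→ℚ (2 ^ n))

expSum-shift-lower : ∀ n → 0ℚ ≤ s → s ≤ ℕ→ℚ 2 → 0ℚ ≤ x →
  (1ℚ + x - x * δ n) * expSum (suc n) s ≤ expSum (suc n) (s + x)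
expSum-shift-lower {s} {x} n 0≤s s≤2 0≤x = ≤-byDifference (identity B E T x (δ n))
  (+-nonNeg (p≤q⇒0≤q-p (expSum-increment-≥ n 0≤s 0≤x))
    (*-nonNeg 0≤x (+-nonNeg (p≤q⇒0≤q-p T≤δ) (*-nonNeg (0≤δ n) (p≤q⇒0≤q-p (1≤expSum n 0≤s))))))
  where
  B E T : ℚ
  B = expSum (suc n) (s + x)
  E = expSum n s
  T = s ^ℚ n ÷ℕ n !
  T≤δ : T ≤ δ n
  T≤δ = ÷ℕ-monoˡ-≤ (n !) (subst (s ^ℚ n ≤_) (ℕ→ℚ-^ 2 n) (^ℚ-mono-≤ n 0≤s s≤2))
  identity : ∀ B E T x d → B - (1ℚ + x - x * d) * (E + T)
    ≡ ((B - (E + T)) - x * E) + x * ((d - T) + d * ((E + T) - 1ℚ))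
  identity = solve-∀ ℚ-ring

expSum-step-up : ∀ n → 0ℚ ≤ s → s ≤ ℕ→ℚ 2 → 0ℚ ≤ x →
  (1ℚ + x) * expSum (suc n) s ≈[ x * (x + δ n) ] expSum (suc n) (s + x)
expSum-step-up {s} {x} n 0≤s s≤2 0≤x = record
  { 0≤error = *-nonNeg 0≤x (+-nonNeg 0≤x (0≤δ n))
  ; 0≤left = *-nonNeg (+-nonNeg 0≤1 0≤x) 0≤A
  ; 0≤right = expSum-nonNeg (suc n) (+-nonNeg 0≤s 0≤x)
  ; shrunk-left≤right = ≤-trans
      (≤-byDifference (identity₁ A x (δ n))
        (*-nonNeg (+-nonNeg (+-nonNeg (*-nonNeg 0≤x 0≤x) (*-nonNeg (*-nonNeg 0≤x 0≤x) 0≤x))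
                            (*-nonNeg (*-nonNeg 0≤x 0≤x) (0≤δ n))) 0≤A))
      (expSum-shift-lower n 0≤s s≤2 0≤x)
  ; shrunk-right≤left = ≤-byDifference (identity₂ A B x (δ n))
      (+-nonNeg (*-nonNeg (+-nonNeg 0≤1 0≤x) (p≤q⇒0≤q-p (expSum-shift-upper n 0≤s 0≤x)))
                (*-nonNeg (*-nonNeg 0≤x (0≤δ n)) (expSum-nonNeg (suc n) (+-nonNeg 0≤s 0≤x)))) }
  where
  A B : ℚ
  A = expSum (suc n) s
  B = expSum (suc n) (s + x)
  0≤A : 0ℚ ≤ A
  0≤A = expSum-nonNeg (suc n) 0≤s
  identity₁ : ∀ A x d → (1ℚ + x - x * d) * A - (1ℚ - x * (x + d)) * ((1ℚ + x) * A) ≡ (x * x + x * x * x + x * x * d) * A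
  identity₁ = solve-∀ ℚ-ring
  identity₂ : ∀ A B x d → (1ℚ + x) * A - (1ℚ - x * (x + d)) * B ≡ (1ℚ + x) * (A - (1ℚ - x) * B) + x * d * B
  identity₂ = solve-∀ ℚ-ring

expSum-step-down : ∀ n → 0ℚ ≤ s → s ≤ ℕ→ℚ 2 → 0ℚ ≤ x → x ≤ 1ℚ →
  expSum (suc n) s ≈[ x * (x + δ n) ] (1ℚ - x) * expSum (suc n) (s + x)
expSum-step-down {s} {x} n 0≤s s≤2 0≤x x≤1 = record
  { 0≤error = *-nonNeg 0≤x (+-nonNeg 0≤x (0≤δ n))
  ; 0≤left = 0≤A
  ; 0≤right = *-nonNeg 0≤1-x 0≤B
  ; shrunk-left≤right = ≤-byDifference (identity₁ A B x (δ n))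
      (+-nonNeg (*-nonNeg 0≤1-x (p≤q⇒0≤q-p (expSum-shift-lower n 0≤s s≤2 0≤x)))
                (*-nonNeg (*-nonNeg (*-nonNeg 0≤x 0≤x) (0≤δ n)) 0≤A))
  ; shrunk-right≤left = ≤-byDifference (identity₂ A B x (δ n))
      (+-nonNeg (p≤q⇒0≤q-p (expSum-shift-upper n 0≤s 0≤x))
                (*-nonNeg (*-nonNeg 0≤x (+-nonNeg 0≤x (0≤δ n))) (*-nonNeg 0≤1-x 0≤B))) }
  where
  A B : ℚ
  A = expSum (suc n) s
  B = expSum (suc n) (s + x)
  0≤A : 0ℚ ≤ A
  0≤A = expSum-nonNeg (suc n) 0≤s
  0≤B : 0ℚ ≤ B
  0≤B = expSum-nonNeg (suc n) (+-nonNeg 0≤s 0≤x)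
  0≤1-x : 0ℚ ≤ 1ℚ - x
  0≤1-x = p≤q⇒0≤q-p x≤1
  identity₁ : ∀ A B x d → (1ℚ - x) * B - (1ℚ - x * (x + d)) * A
    ≡ (1ℚ - x) * (B - (1ℚ + x - x * d) * A) + x * x * d * A
  identity₁ = solve-∀ ℚ-ring
  identity₂ : ∀ A B x d → A - (1ℚ - x * (x + d)) * ((1ℚ - x) * B)
    ≡ (A - (1ℚ - x) * B) + x * (x + d) * ((1ℚ - x) * B)
  identity₂ = solve-∀ ℚ-ring

½*expSum-at-1≤2 : ∀ n → ½ * expSum (suc n) 1ℚ ≤ ℕ→ℚ 2
½*expSum-at-1≤2 n = ≤-trans (expSum-shift-upper n 0≤½ 0≤½) expSum-at-½≤2
  where
  expSum-at-½≤2 : expSum (suc n) ½ ≤ ℕ→ℚ 2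
  expSum-at-½≤2 = subst₂ _≤_ (identity (expSum (suc n) ½)) (*-identityʳ (ℕ→ℚ 2))
    (*-monoˡ-≤-nonNeg′ (0≤ℕ→ℚ 2)
      (subst₂ (λ y z → ½ * expSum (suc n) y ≤ z) (+-identityˡ ½) (expSum-at-0 n) (expSum-shift-upper n ≤-refl 0≤½)))
    where
    identity : ∀ y → ℕ→ℚ 2 * (½ * y) ≡ y
    identity = solve-∀ ℚ-ring

2^[2+k]*[2+k]≤4*[2+k]! : ∀ k → 2 ^ (2 ℕ.+ k) ℕ.* (2 ℕ.+ k) ≤ℕ 4 ℕ.* (2 ℕ.+ k) !
2^[2+k]*[2+k]≤4*[2+k]! zero    = ℕₚ.≤-refl
2^[2+k]*[2+k]≤4*[2+k]! (suc k) = begin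
  2 ℕ.* P ℕ.* (3 ℕ.+ k)            ≤⟨ ℕₚ.*-monoˡ-≤ (3 ℕ.+ k) (ℕₚ.*-monoˡ-≤ P (ℕₚ.m≤m+n 2 k)) ⟩
  (2 ℕ.+ k) ℕ.* P ℕ.* (3 ℕ.+ k)    ≡⟨ cong (ℕ._* (3 ℕ.+ k)) (ℕₚ.*-comm (2 ℕ.+ k) P) ⟩
  P ℕ.* (2 ℕ.+ k) ℕ.* (3 ℕ.+ k)    ≤⟨ ℕₚ.*-monoˡ-≤ (3 ℕ.+ k) (2^[2+k]*[2+k]≤4*[2+k]! k) ⟩
  4 ℕ.* (2 ℕ.+ k) ! ℕ.* (3 ℕ.+ k)  ≡⟨ regroup 4 ((2 ℕ.+ k) !) (3 ℕ.+ k) ⟩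
  4 ℕ.* (3 ℕ.+ k) !                ∎
  where
  open ℕₚ.≤-Reasoning
  P : ℕ
  P = 2 ^ (2 ℕ.+ k)
  regroup : ∀ a b c → a ℕ.* b ℕ.* c ≡ a ℕ.* (c ℕ.* b)
  regroup = solve-∀ ℕ-ring

δ≤4*recip : ∀ n → 2 ≤ℕ n → δ n ≤ ℕ→ℚ 4 * recip n
δ≤4*recip n 2≤n with ℕₚ.m≤n⇒∃[o]m+o≡n 2≤n
... | k , refl = subst (δ (2 ℕ.+ k) ≤_) (÷ℕ≡*recip (ℕ→ℚ 4) (2 ℕ.+ k))
  (fraction-≤ {2 ^ (2 ℕ.+ k)} {4} (ℕₚ.1≤n! (2 ℕ.+ k)) (ℕ.s≤s ℕ.z≤n) (2^[2+k]*[2+k]≤4*[2+k]! k))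

prodℚ : (ℕ → ℚ) → ℕ → ℚ
prodℚ f zero    = 1ℚ
prodℚ f (suc k) = prodℚ f k * f k

prodℚ-pos : ∀ {f} k → (∀ i → i <ℕ k → 0ℚ < f i) → 0ℚ < prodℚ f k
prodℚ-pos zero    _   = 0<1
prodℚ-pos (suc k) f>0 = *-pos (prodℚ-pos k (λ i i<k → f>0 i (ℕₚ.m<n⇒m<1+n i<k))) (f>0 k ℕₚ.≤-refl)

-- Products of factors (K ± j)/K against the exponential series

-- The running product F/G of factors (K ± j)/K is compared with E(S/K) along a walk of
-- positions S; every step of length j ≤ K/a costs relative error μ j/K.
module Telescoping (K a M : ℕ) (1≤K : 1 ≤ℕ K) (1≤a : 1 ≤ℕ a) where

  E : ℚ → ℚ
  E = expSum (suc M)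

  frac : ℕ → ℚ
  frac n = ℕ→ℚ n ÷ℕ K

  μ : ℚ
  μ = recip a + δ M

  frac-+ : ∀ m n → frac (m ℕ.+ n) ≡ frac m + frac n
  frac-+ m n = begin
    ℕ→ℚ (m ℕ.+ n) ÷ℕ K                  ≡⟨ ÷ℕ≡*recip (ℕ→ℚ (m ℕ.+ n)) K ⟩
    ℕ→ℚ (m ℕ.+ n) * recip K             ≡⟨ cong (_* recip K) (ℕ→ℚ-+ m n) ⟩
    (ℕ→ℚ m + ℕ→ℚ n) * recip K           ≡⟨ *-distribʳ-+ (recip K) (ℕ→ℚ m) (ℕ→ℚ n) ⟩
    ℕ→ℚ m * recip K + ℕ→ℚ n * recip K   ≡⟨ cong₂ _+_ (÷ℕ≡*recip (ℕ→ℚ m) K) (÷ℕ≡*recip (ℕ→ℚ n) K) ⟨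
    frac m + frac n                     ∎
    where open ≡-Reasoning

  frac-K : frac K ≡ 1ℚ
  frac-K = trans (÷ℕ≡*recip (ℕ→ℚ K) K) (ℕ→ℚ*recip≡1 1≤K)

  frac-0 : frac 0 ≡ 0ℚ
  frac-0 = trans (÷ℕ≡*recip 0ℚ K) (*-zeroˡ (recip K))

  0≤frac : ∀ n → 0ℚ ≤ frac n
  0≤frac n = 0≤÷ℕ K (0≤ℕ→ℚ n)

  frac≤recip : ∀ {j} → j ℕ.* a ≤ℕ K → frac j ≤ recip a
  frac≤recip {j} ja≤K = fraction-≤ {j} {1} 1≤K 1≤a (subst (j ℕ.* a ≤ℕ_) (sym (ℕₚ.*-identityˡ K)) ja≤K)

  frac≤2 : ∀ {S} → S ≤ℕ 2 ℕ.* K → frac S ≤ ℕ→ℚ 2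
  frac≤2 {S} S≤2K = subst (frac S ≤_) (*-identityʳ (ℕ→ℚ 2))
    (fraction-≤ {S} {2} 1≤K (ℕ.s≤s ℕ.z≤n) (subst (ℕ._≤ 2 ℕ.* K) (sym (ℕₚ.*-identityʳ S)) S≤2K))

  recip≤1 : recip a ≤ 1ℚ
  recip≤1 = fraction-≤ {1} {1} {a} {1} 1≤a (ℕ.s≤s ℕ.z≤n) (subst (1 ≤ℕ_) (sym (ℕₚ.*-identityˡ a)) 1≤a)

  step-error≤ : ∀ {x} → 0ℚ ≤ x → x ≤ recip a → x * (x + δ M) ≤ μ * x
  step-error≤ {x} 0≤x x≤1/a = ≤-byDifference (identity x (recip a) (δ M)) (*-nonNeg 0≤x (p≤q⇒0≤q-p x≤1/a))
    where
    identity : ∀ x w d → (w + d) * x - x * (x + d) ≡ x * (w - x)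
    identity = solve-∀ ℚ-ring

  error-+ : ∀ T j → μ * frac T + μ * frac j ≡ μ * frac (T ℕ.+ j)
  error-+ T j = trans (sym (*-distribˡ-+ μ (frac T) (frac j))) (cong (μ *_) (sym (frac-+ T j)))

  0<E : 0ℚ ≤ s → 0ℚ < E s
  0<E 0≤s = <-≤-trans 0<1 (1≤expSum M 0≤s)

  0≤left-factor : ∀ {G s} → 0ℚ ≤ s → 0ℚ ≤ G * E s → 0ℚ ≤ G
  0≤left-factor {G} {s} 0≤s 0≤GE =
    *-cancelʳ-≤-pos (E s) {{positive (0<E 0≤s)}} (subst (_≤ G * E s) (sym (*-zeroˡ (E s))) 0≤GE)

  stepUp : ∀ {F G A S T} j → j ℕ.* a ≤ℕ K → S ≤ℕ 2 ℕ.* K →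
    F * A ≈[ μ * frac T ] G * E (frac S) →
    (F * frac (K ℕ.+ j)) * A ≈[ μ * frac (T ℕ.+ j) ] G * E (frac (S ℕ.+ j))
  stepUp {F} {G} {A} {S} {T} j ja≤K S≤2K FA≈GE =
    ≈-cong (regroup f F A) (error-+ T j) (cong (λ s → G * E s) (sym (frac-+ S j)))
      (≈-trans scaled (≈-*ˡ (0≤left-factor {G} (0≤frac S) (0≤right FA≈GE)) exp-step))
    where
    Δ f : ℚ
    Δ = frac j
    f = frac (K ℕ.+ j)
    f≡1+Δ : f ≡ 1ℚ + Δ
    f≡1+Δ = trans (frac-+ K j) (cong (_+ Δ) frac-K)
    regroup : ∀ f F A → f * (F * A) ≡ (F * f) * A
    regroup = solve-∀ ℚ-ring
    regroup′ : ∀ c G e → c * (G * e) ≡ G * (c * e)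
    regroup′ = solve-∀ ℚ-ring
    scaled : f * (F * A) ≈[ μ * frac T ] G * ((1ℚ + Δ) * E (frac S))
    scaled = ≈-cong refl refl (trans (cong (_* (G * E (frac S))) f≡1+Δ) (regroup′ (1ℚ + Δ) G (E (frac S))))
      (≈-*ˡ (0≤frac (K ℕ.+ j)) FA≈GE)
    exp-step : (1ℚ + Δ) * E (frac S) ≈[ μ * Δ ] E (frac S + Δ)
    exp-step = ≈-weaken (step-error≤ {Δ} (0≤frac j) (frac≤recip {j} ja≤K))
      (expSum-step-up M (0≤frac S) (frac≤2 S≤2K) (0≤frac j))

  frac[K∸j]≡1-frac[j] : ∀ {j} → j ≤ℕ K → frac (K ∸ j) ≡ 1ℚ - frac j
  frac[K∸j]≡1-frac[j] {j} j≤K = begin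
    frac (K ∸ j)                      ≡⟨ identity (frac (K ∸ j)) (frac j) ⟩
    (frac (K ∸ j) + frac j) - frac j  ≡⟨ cong (_- frac j) (frac-+ (K ∸ j) j) ⟨
    frac (K ∸ j ℕ.+ j) - frac j       ≡⟨ cong (λ n → frac n - frac j) (ℕₚ.m∸n+n≡m j≤K) ⟩
    frac K - frac j                   ≡⟨ cong (_- frac j) frac-K ⟩
    1ℚ - frac j                       ∎
    where
    open ≡-Reasoning
    identity : ∀ u v → u ≡ (u + v) - v
    identity = solve-∀ ℚ-ring

  j*a≤K⇒j≤K : ∀ {j} → j ℕ.* a ≤ℕ K → j ≤ℕ K
  j*a≤K⇒j≤K {j} ja≤K = ℕₚ.≤-trans (ℕₚ.m≤m*n j a {{ℕ.>-nonZero 1≤a}}) ja≤K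

  stepDown : ∀ {F G A S T} j → j ℕ.* a ≤ℕ K → S ≤ℕ 2 ℕ.* K →
    F * A ≈[ μ * frac T ] G * E (frac S) →
    F * A ≈[ μ * frac (T ℕ.+ j) ] (G * frac (K ∸ j)) * E (frac (S ℕ.+ j))
  stepDown {F} {G} {A} {S} {T} j ja≤K S≤2K FA≈GE =
    ≈-cong refl (error-+ T j) reassemble (≈-trans FA≈GE (≈-*ˡ (0≤left-factor {G} (0≤frac S) (0≤right FA≈GE)) exp-step))
    where
    Δ : ℚ
    Δ = frac j
    exp-step : E (frac S) ≈[ μ * Δ ] (1ℚ - Δ) * E (frac S + Δ)
    exp-step = ≈-weaken (step-error≤ {Δ} (0≤frac j) (frac≤recip {j} ja≤K))
      (expSum-step-down M (0≤frac S) (frac≤2 S≤2K) (0≤frac j) (≤-trans (frac≤recip {j} ja≤K) recip≤1))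
    reassemble : G * ((1ℚ - Δ) * E (frac S + Δ)) ≡ (G * frac (K ∸ j)) * E (frac (S ℕ.+ j))
    reassemble = trans (sym (*-assoc G (1ℚ - Δ) (E (frac S + Δ))))
      (cong₂ (λ f s → G * f * E s) (sym (frac[K∸j]≡1-frac[j] {j} (j*a≤K⇒j≤K {j} ja≤K))) (sym (frac-+ S j)))

  ∏⁺ ∏⁻ : (ℕ → ℕ) → ℕ → ℚ
  ∏⁺ j k = prodℚ (λ i → frac (K ℕ.+ j i)) k
  ∏⁻ j k = prodℚ (λ i → frac (K ∸ j i)) k

  -- F / G approximates E(S/K) / A with relative error μ T/K.
  record Tracks (F G A : ℚ) (S T : ℕ) : Set where
    constructor tracks
    field approximation : F * A ≈[ μ * frac T ] G * E (frac S)

  start : ∀ S → Tracks 1ℚ 1ℚ (E (frac S)) S 0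
  start S = tracks (≈-cong refl (sym (trans (cong (μ *_) frac-0) (*-zeroʳ μ))) refl
    (≈-refl (*-nonNeg 0≤1 (≤-trans 0≤1 (1≤expSum M (0≤frac S))))))

  blockUp : ∀ {F G A S T} j k → (∀ i → i <ℕ k → j i ℕ.* a ≤ℕ K) → S ℕ.+ sumℕ j k ≤ℕ 2 ℕ.* K →
    Tracks F G A S T → Tracks (F * ∏⁺ j k) G A (S ℕ.+ sumℕ j k) (T ℕ.+ sumℕ j k)
  blockUp {F} {G} {A} {S} {T} j zero    _       _    (tracks FA≈GE) = tracks (≈-cong (cong (_* A) (sym (*-identityʳ F)))
    (cong (λ n → μ * frac n) (sym (ℕₚ.+-identityʳ T))) (cong (λ n → G * E (frac n)) (sym (ℕₚ.+-identityʳ S))) FA≈GE)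
  blockUp {F} {G} {A} {S} {T} j (suc k) bounded fits walk = tracks (≈-cong (cong (_* A) (*-assoc F (∏⁺ j k) f))
    (cong (λ n → μ * frac n) (ℕₚ.+-assoc T (sumℕ j k) (j k))) (cong (λ n → G * E (frac n)) (ℕₚ.+-assoc S (sumℕ j k) (j k)))
    (stepUp {F * ∏⁺ j k} {G} {A} {S ℕ.+ sumℕ j k} {T ℕ.+ sumℕ j k} (j k) (bounded k ℕₚ.≤-refl) fits′
      (Tracks.approximation (blockUp j k (λ i i<k → bounded i (ℕₚ.m<n⇒m<1+n i<k)) fits′ walk))))
    where
    f : ℚ
    f = frac (K ℕ.+ j k)
    fits′ : S ℕ.+ sumℕ j k ≤ℕ 2 ℕ.* K
    fits′ = ℕₚ.≤-trans (ℕₚ.+-monoʳ-≤ S (ℕₚ.m≤m+n (sumℕ j k) (j k))) fits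

  blockDown : ∀ {F G A S T} j k → (∀ i → i <ℕ k → j i ℕ.* a ≤ℕ K) → S ℕ.+ sumℕ j k ≤ℕ 2 ℕ.* K →
    Tracks F G A S T → Tracks F (G * ∏⁻ j k) A (S ℕ.+ sumℕ j k) (T ℕ.+ sumℕ j k)
  blockDown {F} {G} {A} {S} {T} j zero    _       _    (tracks FA≈GE) = tracks (≈-cong refl
    (cong (λ n → μ * frac n) (sym (ℕₚ.+-identityʳ T)))
    (cong₂ (λ H n → H * E (frac n)) (sym (*-identityʳ G)) (sym (ℕₚ.+-identityʳ S))) FA≈GE)
  blockDown {F} {G} {A} {S} {T} j (suc k) bounded fits walk = tracks (≈-cong refl
    (cong (λ n → μ * frac n) (ℕₚ.+-assoc T (sumℕ j k) (j k)))
    (cong₂ (λ H n → H * E (frac n)) (*-assoc G (∏⁻ j k) g) (ℕₚ.+-assoc S (sumℕ j k) (j k)))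
    (stepDown {F} {G * ∏⁻ j k} {A} {S ℕ.+ sumℕ j k} {T ℕ.+ sumℕ j k} (j k) (bounded k ℕₚ.≤-refl) fits′
      (Tracks.approximation (blockDown j k (λ i i<k → bounded i (ℕₚ.m<n⇒m<1+n i<k)) fits′ walk))))
    where
    g : ℚ
    g = frac (K ∸ j k)
    fits′ : S ℕ.+ sumℕ j k ≤ℕ 2 ℕ.* K
    fits′ = ℕₚ.≤-trans (ℕₚ.+-monoʳ-≤ S (ℕₚ.m≤m+n (sumℕ j k) (j k))) fits

  prodℚ-frac : ∀ g k → prodℚ (λ i → frac (g i)) k ≡ ℕ→ℚ (prodℕ g k) * recip K ^ℚ k
  prodℚ-frac g zero    = refl
  prodℚ-frac g (suc k) = begin
    prodℚ (λ i → frac (g i)) k * frac (g k)                       ≡⟨ cong₂ _*_ (prodℚ-frac g k) (÷ℕ≡*recip (ℕ→ℚ (g k)) K) ⟩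
    ℕ→ℚ (prodℕ g k) * recip K ^ℚ k * (ℕ→ℚ (g k) * recip K)       ≡⟨ regroup (ℕ→ℚ (prodℕ g k)) (ℕ→ℚ (g k)) (recip K) (recip K ^ℚ k) ⟩
    ℕ→ℚ (prodℕ g k) * ℕ→ℚ (g k) * (recip K * recip K ^ℚ k)       ≡⟨ cong (_* (recip K * recip K ^ℚ k)) (ℕ→ℚ-* (prodℕ g k) (g k)) ⟨
    ℕ→ℚ (prodℕ g k ℕ.* g k) * recip K ^ℚ suc k                   ∎
    where
    open ≡-Reasoning
    regroup : ∀ P x r R → P * R * (x * r) ≡ P * x * (r * R)
    regroup = solve-∀ ℚ-ring

  0<frac[K+j] : ∀ j → 0ℚ < frac (K ℕ.+ j)
  0<frac[K+j] j = <-≤-trans 0<1 (subst (1ℚ ≤_) (sym (trans (frac-+ K j) (cong (_+ frac j) frac-K))) (p≤p+q {frac j} {1ℚ} (0≤frac j)))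

  0<frac[K∸j] : ∀ {j} → 2 ≤ℕ a → j ℕ.* a ≤ℕ K → 0ℚ < frac (K ∸ j)
  0<frac[K∸j] {j} 2≤a ja≤K = subst (0ℚ <_) (sym (frac[K∸j]≡1-frac[j] {j} (j*a≤K⇒j≤K {j} ja≤K)))
    (<-≤-trans 0<½ (≤-byDifference (identity (frac j) (recip a)) (+-nonNeg (p≤q⇒0≤q-p recip≤½) (p≤q⇒0≤q-p (frac≤recip {j} ja≤K)))))
    where
    recip≤½ : recip a ≤ ½
    recip≤½ = fraction-≤ {1} {1} {a} {2} 1≤a (ℕ.s≤s ℕ.z≤n) (subst (2 ≤ℕ_) (sym (ℕₚ.*-identityˡ a)) 2≤a)
    identity : ∀ x w → (1ℚ - x) - ½ ≡ (½ - w) + (w - x)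
    identity = solve-∀ ℚ-ring

bracket : ℕ → ℚ
bracket a = (ℤ→ℚ ((+ (32 ℕ.* a ^ 2 ℕ.* (a ^ 2 ∸ 1))) ℤ.- (+ 6)) * (ℕ→ℚ (4 ℕ.* a ℕ.+ 1) ÷ℕ (4 ℕ.* a)))
            ÷ℕ ((4 ℕ.* a ^ 2 ℕ.+ 2) ℕ.* (4 ℕ.* a ^ 2 ℕ.+ 1) ℕ.* (4 ℕ.* a ^ 2 ∸ 3) ℕ.* (a ℕ.+ 1))

binomialRatio : ℕ → ℚ
binomialRatio a = ℕ→ℚ (((8 ℕ.* a ^ 2 ∸ 1) C (4 ℕ.* a ^ 2 ∸ 1)) ℕ.* ((8 ℕ.* a ^ 2 ∸ 5) C (4 ℕ.* a ^ 2 ∸ 1)))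
  ÷ℕ (((8 ℕ.* a ^ 2 ℕ.+ 2 ℕ.* a ∸ 1) C (4 ℕ.* a ^ 2 ℕ.+ a ∸ 1)) ℕ.* ((8 ℕ.* a ^ 2 ∸ 2 ℕ.* a ∸ 5) C (4 ℕ.* a ^ 2 ℕ.+ a ∸ 1)))

RHS≡bracket*binomialRatio : ∀ a → RHS a ≡ bracket a * binomialRatio a
RHS≡bracket*binomialRatio a = refl

nested-fraction : ∀ x y z {m n} → 1 ≤ℕ m → 1 ≤ℕ n →
  ℕ→ℚ z * ((ℕ→ℚ x * (ℕ→ℚ y ÷ℕ m)) ÷ℕ n) ≡ ℕ→ℚ (z ℕ.* (x ℕ.* y)) ÷ℕ (m ℕ.* n)
nested-fraction x y z {m} {n} 1≤m 1≤n = begin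
  ℕ→ℚ z * ((ℕ→ℚ x * (ℕ→ℚ y ÷ℕ m)) ÷ℕ n)
    ≡⟨ cong (ℕ→ℚ z *_) (trans (÷ℕ≡*recip _ n) (cong (λ v → ℕ→ℚ x * v * recip n) (÷ℕ≡*recip (ℕ→ℚ y) m))) ⟩
  ℕ→ℚ z * (ℕ→ℚ x * (ℕ→ℚ y * recip m) * recip n)
    ≡⟨ regroup (ℕ→ℚ z) (ℕ→ℚ x) (ℕ→ℚ y) (recip m) (recip n) ⟩
  ℕ→ℚ z * (ℕ→ℚ x * ℕ→ℚ y) * (recip m * recip n)
    ≡⟨ cong₂ _*_ (trans (ℕ→ℚ-* z (x ℕ.* y)) (cong (ℕ→ℚ z *_) (ℕ→ℚ-* x y))) (recip-* 1≤m 1≤n) ⟨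
  ℕ→ℚ (z ℕ.* (x ℕ.* y)) * recip (m ℕ.* n)
    ≡⟨ ÷ℕ≡*recip _ (m ℕ.* n) ⟨
  ℕ→ℚ (z ℕ.* (x ℕ.* y)) ÷ℕ (m ℕ.* n) ∎
  where
  open ≡-Reasoning
  regroup : ∀ z x y r s → z * (x * (y * r) * s) ≡ z * (x * y) * (r * s)
  regroup = solve-∀ ℚ-ring

cube*bracket≡fraction : ∀ a → 2 ≤ℕ a → ℕ→ℚ (a ^ 3) * bracket a ≡ ℕ→ℚ (numerator a) ÷ℕ denominator a
cube*bracket≡fraction a 2≤a = trans
  (cong (λ z → ℕ→ℚ (a ^ 3) * ((ℤ→ℚ z * (ℕ→ℚ (4 ℕ.* a ℕ.+ 1) ÷ℕ (4 ℕ.* a))) ÷ℕ bracketDenominator a)) numerator-ℤ)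
  (nested-fraction (M ∸ 6) (4 ℕ.* a ℕ.+ 1) (a ^ 3) 1≤4a (1≤bracketDenominator a 2≤a))
  where
  M : ℕ
  M = 32 ℕ.* a ^ 2 ℕ.* (a ^ 2 ∸ 1)
  1≤a : 1 ≤ℕ a
  1≤a = ℕₚ.≤-trans (ℕ.s≤s ℕ.z≤n) 2≤a
  1≤4a : 1 ≤ℕ 4 ℕ.* a
  1≤4a = ℕₚ.≤-trans 1≤a (ℕₚ.m≤n*m a 4)
  numerator-ℤ : (+ M) ℤ.- (+ 6) ≡ + (M ∸ 6)
  numerator-ℤ = trans (ℤₚ.m-n≡m⊖n M 6) (ℤₚ.⊖-≥ (32a²[a²∸1]≥6 a 2≤a))

[1-2/a]*½≡[a∸2]/2a : ∀ {a} → 2 ≤ℕ a → (1ℚ - ℕ→ℚ 2 * recip a) * ½ ≡ ℕ→ℚ (a ∸ 2) ÷ℕ (2 ℕ.* a)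
[1-2/a]*½≡[a∸2]/2a {a} 2≤a = begin
  (1ℚ - ℕ→ℚ 2 * recip a) * ½                       ≡⟨ cong (λ u → (u - ℕ→ℚ 2 * recip a) * ½) [A+2]*r≡1 ⟨
  ((A + ℕ→ℚ 2) * recip a - ℕ→ℚ 2 * recip a) * ½    ≡⟨ regroup A (ℕ→ℚ 2) (recip a) ⟩
  A * (½ * recip a)                                ≡⟨ cong (A *_) (recip-* {2} (ℕ.s≤s ℕ.z≤n) 1≤a) ⟨
  A * recip (2 ℕ.* a)                              ≡⟨ ÷ℕ≡*recip A (2 ℕ.* a) ⟨
  A ÷ℕ (2 ℕ.* a)                                   ∎
  where
  open ≡-Reasoning
  A : ℚ
  A = ℕ→ℚ (a ∸ 2)
  1≤a : 1 ≤ℕ a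
  1≤a = ℕₚ.≤-trans (ℕ.s≤s ℕ.z≤n) 2≤a
  [A+2]*r≡1 : (A + ℕ→ℚ 2) * recip a ≡ 1ℚ
  [A+2]*r≡1 = trans (cong (_* recip a) (trans (sym (ℕ→ℚ-+ (a ∸ 2) 2)) (cong ℕ→ℚ (ℕₚ.m∸n+n≡m 2≤a))))
    (ℕ→ℚ*recip≡1 1≤a)
  regroup : ∀ A t r → ((A + t) * r - t * r) * ½ ≡ A * (½ * r)
  regroup = solve-∀ ℚ-ring

cube*bracket≈½ : ∀ a → 2 ≤ℕ a → ℕ→ℚ (a ^ 3) * bracket a ≈[ ℕ→ℚ 2 * recip a ] ½
cube*bracket≈½ a 2≤a = ≈-cong (sym (cube*bracket≡fraction a 2≤a)) refl refl
  (≈-fromBounds (*-nonNeg (0≤ℕ→ℚ 2) (0≤recip a)) (0≤÷ℕ (denominator a) (0≤ℕ→ℚ (numerator a)))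
    (subst (_≤ ℕ→ℚ (numerator a) ÷ℕ denominator a) (sym ([1-2/a]*½≡[a∸2]/2a 2≤a))
      (fraction-≤ {a ∸ 2} {numerator a} 1≤2a (1≤denominator a 2≤a) ([a∸2]*denominator≤numerator*2a a 2≤a)))
    (fraction-≤ {numerator a} {1} {denominator a} {2} (1≤denominator a 2≤a) (ℕ.s≤s ℕ.z≤n) (numerator*2≤denominator a 2≤a)))
  where
  1≤2a : 1 ≤ℕ 2 ℕ.* a
  1≤2a = ℕₚ.≤-trans (ℕₚ.≤-trans (ℕ.s≤s ℕ.z≤n) 2≤a) (ℕₚ.m≤n*m a 2)

-- The approximation for fixed a and M

module Approximation (a M : ℕ) (5≤a : 5 ≤ℕ a) (2≤M : 2 ≤ℕ M) where

  open Schedule a 5≤a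

  2≤a : 2 ≤ℕ a
  2≤a = ℕₚ.≤-trans (ℕ.s≤s (ℕ.s≤s ℕ.z≤n)) 5≤a

  1≤a : 1 ≤ℕ a
  1≤a = ℕₚ.≤-trans (ℕ.s≤s ℕ.z≤n) 2≤a

  open Telescoping K a M 1≤K 1≤a

  Fᴬ Gᴬ Fᴮ Gᴮ : ℚ
  Fᴬ = ((1ℚ * ∏⁺ (progression 0 2) a) * ∏⁺ (progression 2 2) a) * ∏⁺ (progression 0 2) a
  Gᴬ = 1ℚ * ∏⁻ (progression 8 2) (3 ℕ.* a)
  Fᴮ = 1ℚ * ∏⁺ (progression 0 1) (2 ℕ.* a)
  Gᴮ = 1ℚ * ∏⁻ (progression 5 1) (2 ℕ.* a)

  walkA : Tracks Fᴬ Gᴬ (E (frac 0)) lengthA lengthA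
  walkA =
    blockDown (progression 8 2) (3 ℕ.* a) (steps≤ 8 2 (3 ℕ.* a) 8+2[3a]≤8a) lengthA≤2K
    (blockUp (progression 0 2) a (steps≤ 0 2 a 0+2a≤8a) (prefix≤ (ℕₚ.m≤m+n _ _))
    (blockUp (progression 2 2) a (steps≤ 2 2 a 2+2a≤8a) (prefix≤ (ℕₚ.≤-trans (ℕₚ.m≤m+n _ _) (ℕₚ.m≤m+n _ _)))
    (blockUp (progression 0 2) a (steps≤ 0 2 a 0+2a≤8a) (prefix≤ (ℕₚ.≤-trans (ℕₚ.m≤m+n _ _) (ℕₚ.≤-trans (ℕₚ.m≤m+n _ _) (ℕₚ.m≤m+n _ _))))
    (start 0))))
    where
    prefix≤ : ∀ {P} → P ≤ℕ lengthA → P ≤ℕ 2 ℕ.* K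
    prefix≤ P≤lengthA = ℕₚ.≤-trans P≤lengthA lengthA≤2K

  walkB : Tracks Fᴮ Gᴮ (E (frac (K ℕ.+ 12 ℕ.* a))) endB lengthB
  walkB =
    blockDown (progression 5 1) (2 ℕ.* a) (steps≤ 5 1 (2 ℕ.* a) 5+[2a]≤8a) endB≤2K
    (blockUp (progression 0 1) (2 ℕ.* a) (steps≤ 0 1 (2 ℕ.* a) 0+[2a]≤8a) (ℕₚ.≤-trans (ℕₚ.m≤m+n _ _) endB≤2K)
    (start (K ℕ.+ 12 ℕ.* a)))
    where
    endB≤2K : endB ≤ℕ 2 ℕ.* K
    endB≤2K = subst (ℕ._≤ 2 ℕ.* K) (sym endB≡lengthA) lengthA≤2K

  0<Gᴬ : 0ℚ < Gᴬ
  0<Gᴬ = *-pos 0<1 (prodℚ-pos (3 ℕ.* a) (λ i i<3a → 0<frac[K∸j] 2≤a (steps≤ 8 2 (3 ℕ.* a) 8+2[3a]≤8a i i<3a)))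

  0<Gᴮ : 0ℚ < Gᴮ
  0<Gᴮ = *-pos 0<1 (prodℚ-pos (2 ℕ.* a) (λ i i<2a → 0<frac[K∸j] 2≤a (steps≤ 5 1 (2 ℕ.* a) 5+[2a]≤8a i i<2a)))

  0<Fᴮ : 0ℚ < Fᴮ
  0<Fᴮ = *-pos 0<1 (prodℚ-pos (2 ℕ.* a) (λ i _ → 0<frac[K+j] (progression 0 1 i)))

  spliced : (Fᴬ * Gᴮ) * E (frac 0) ≈[ μ * frac lengthA + μ * frac lengthB ] (Gᴬ * Fᴮ) * E (frac (K ℕ.+ 12 ℕ.* a))
  spliced = ≈-splice {F = Fᴬ} {G = Gᴬ} {F′ = Fᴮ} {G′ = Gᴮ} {A = E (frac 0)} {B = E (frac lengthA)} {C = E (frac (K ℕ.+ 12 ℕ.* a))}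
    (<⇒≤ 0<Gᴬ) (<⇒≤ 0<Gᴮ) (Tracks.approximation walkA)
    (≈-cong refl refl (cong (λ S → Gᴮ * E (frac S)) endB≡lengthA) (Tracks.approximation walkB))

  ratio-identity : binomialRatio a * (Gᴬ * Fᴮ) ≡ Fᴬ * Gᴮ
  ratio-identity = begin
    binomialRatio a * (Gᴬ * Fᴮ)
      ≡⟨ cong₂ _*_ (÷ℕ≡*recip (ℕ→ℚ (C₁ ℕ.* C₂)) (C₃ ℕ.* C₄))
           (cong₂ _*_ (cong (1ℚ *_) (trans (prodℚ-frac (λ i → K ∸ progression 8 2 i) (3 ℕ.* a)) (cong (ℕ→ℚ P₃ *_) ρ³)))
                      (cong (1ℚ *_) (prodℚ-frac (λ i → K ℕ.+ progression 0 1 i) (2 ℕ.* a)))) ⟩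
    ℕ→ℚ (C₁ ℕ.* C₂) * κ * ((1ℚ * (ℕ→ℚ P₃ * (ρ * (ρ * ρ)))) * (1ℚ * (ℕ→ℚ P₅ * ρ₂)))
      ≡⟨ regroup (ℕ→ℚ (C₁ ℕ.* C₂)) κ (ℕ→ℚ P₃) (ℕ→ℚ P₅) ρ ρ₂ ⟩
    κ * (ℕ→ℚ (C₁ ℕ.* C₂) * (ℕ→ℚ P₃ * ℕ→ℚ P₅)) * (ρ * (ρ * ρ) * ρ₂)
      ≡⟨ cong (λ v → κ * v * (ρ * (ρ * ρ) * ρ₂)) (trans (ℕ→ℚ-* (C₁ ℕ.* C₂) (P₃ ℕ.* P₅)) (cong (ℕ→ℚ (C₁ ℕ.* C₂) *_) (ℕ→ℚ-* P₃ P₅))) ⟨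
    κ * ℕ→ℚ ((C₁ ℕ.* C₂) ℕ.* (P₃ ℕ.* P₅)) * (ρ * (ρ * ρ) * ρ₂)
      ≡⟨ cong (λ v → κ * ℕ→ℚ v * (ρ * (ρ * ρ) * ρ₂)) binomial-identity ⟩
    κ * ℕ→ℚ ((C₃ ℕ.* C₄) ℕ.* (P₁ ℕ.* P₂ ℕ.* P₁ ℕ.* P₄)) * (ρ * (ρ * ρ) * ρ₂)
      ≡⟨ cong (λ v → κ * v * (ρ * (ρ * ρ) * ρ₂)) ℕ→ℚ-numerators ⟩
    κ * (ℕ→ℚ (C₃ ℕ.* C₄) * (ℕ→ℚ P₁ * ℕ→ℚ P₂ * ℕ→ℚ P₁ * ℕ→ℚ P₄)) * (ρ * (ρ * ρ) * ρ₂)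
      ≡⟨ regroup′ (ℕ→ℚ (C₃ ℕ.* C₄)) κ (ℕ→ℚ P₁) (ℕ→ℚ P₂) (ℕ→ℚ P₄) ρ ρ₂ ⟩
    ℕ→ℚ (C₃ ℕ.* C₄) * κ * Π
      ≡⟨ cong (_* Π) (ℕ→ℚ*recip≡1 1≤C₃*C₄) ⟩
    1ℚ * Π
      ≡⟨ *-identityˡ Π ⟩
    (((1ℚ * (ℕ→ℚ P₁ * ρ)) * (ℕ→ℚ P₂ * ρ)) * (ℕ→ℚ P₁ * ρ)) * (1ℚ * (ℕ→ℚ P₄ * ρ₂))
      ≡⟨ cong₂ (λ x y → (((1ℚ * x) * y) * x) * (1ℚ * (ℕ→ℚ P₄ * ρ₂)))
               (prodℚ-frac (λ i → K ℕ.+ progression 0 2 i) a) (prodℚ-frac (λ i → K ℕ.+ progression 2 2 i) a) ⟨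
    (((1ℚ * ∏⁺ (progression 0 2) a) * ∏⁺ (progression 2 2) a) * ∏⁺ (progression 0 2) a) * (1ℚ * (ℕ→ℚ P₄ * ρ₂))
      ≡⟨ cong (λ x → Fᴬ * (1ℚ * x)) (prodℚ-frac (λ i → K ∸ progression 5 1 i) (2 ℕ.* a)) ⟨
    Fᴬ * Gᴮ ∎
    where
    open ≡-Reasoning
    κ ρ ρ₂ : ℚ
    κ = recip (C₃ ℕ.* C₄)
    ρ = recip K ^ℚ a
    ρ₂ = recip K ^ℚ (2 ℕ.* a)
    Π : ℚ
    Π = (((1ℚ * (ℕ→ℚ P₁ * ρ)) * (ℕ→ℚ P₂ * ρ)) * (ℕ→ℚ P₁ * ρ)) * (1ℚ * (ℕ→ℚ P₄ * ρ₂))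
    ρ³ : recip K ^ℚ (3 ℕ.* a) ≡ ρ * (ρ * ρ)
    ρ³ = trans (^ℚ-+ a (2 ℕ.* a)) (cong (ρ *_) (trans (^ℚ-+ a (1 ℕ.* a)) (cong (λ k → ρ * recip K ^ℚ k) (ℕₚ.*-identityˡ a))))
    ℕ→ℚ-numerators : ℕ→ℚ ((C₃ ℕ.* C₄) ℕ.* (P₁ ℕ.* P₂ ℕ.* P₁ ℕ.* P₄))
                   ≡ ℕ→ℚ (C₃ ℕ.* C₄) * (ℕ→ℚ P₁ * ℕ→ℚ P₂ * ℕ→ℚ P₁ * ℕ→ℚ P₄)
    ℕ→ℚ-numerators = trans (ℕ→ℚ-* (C₃ ℕ.* C₄) _) (cong (ℕ→ℚ (C₃ ℕ.* C₄) *_)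
      (trans (ℕ→ℚ-* (P₁ ℕ.* P₂ ℕ.* P₁) P₄) (cong (_* ℕ→ℚ P₄)
        (trans (ℕ→ℚ-* (P₁ ℕ.* P₂) P₁) (cong (_* ℕ→ℚ P₁) (ℕ→ℚ-* P₁ P₂))))))
    regroup : ∀ C k p₄ p₆ r r₂ → C * k * ((1ℚ * (p₄ * (r * (r * r)))) * (1ℚ * (p₆ * r₂)))
                                ≡ k * (C * (p₄ * p₆)) * (r * (r * r) * r₂)
    regroup = solve-∀ ℚ-ring
    regroup′ : ∀ C k p₁ p₂ p₅ r r₂ → k * (C * (p₁ * p₂ * p₁ * p₅)) * (r * (r * r) * r₂)
                                   ≡ C * k * ((((1ℚ * (p₁ * r)) * (p₂ * r)) * (p₁ * r)) * (1ℚ * (p₅ * r₂)))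
    regroup′ = solve-∀ ℚ-ring

  x₀ : ℚ
  x₀ = frac (12 ℕ.* a)

  binomialRatio≈E : binomialRatio a ≈[ μ * frac lengthA + μ * frac lengthB ] E (1ℚ + x₀)
  binomialRatio≈E = ≈-cancelˡ (*-pos 0<Gᴬ 0<Fᴮ) (≈-cong start-value refl end-value spliced)
    where
    start-value : (Fᴬ * Gᴮ) * E (frac 0) ≡ (Gᴬ * Fᴮ) * binomialRatio a
    start-value = begin
      (Fᴬ * Gᴮ) * E (frac 0)             ≡⟨ cong (λ s → (Fᴬ * Gᴮ) * E s) frac-0 ⟩
      (Fᴬ * Gᴮ) * E 0ℚ                   ≡⟨ cong ((Fᴬ * Gᴮ) *_) (expSum-at-0 M) ⟩
      (Fᴬ * Gᴮ) * 1ℚ                     ≡⟨ *-identityʳ (Fᴬ * Gᴮ) ⟩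
      Fᴬ * Gᴮ                            ≡⟨ ratio-identity ⟨
      binomialRatio a * (Gᴬ * Fᴮ)        ≡⟨ *-comm (binomialRatio a) (Gᴬ * Fᴮ) ⟩
      (Gᴬ * Fᴮ) * binomialRatio a        ∎
      where open ≡-Reasoning
    end-value : (Gᴬ * Fᴮ) * E (frac (K ℕ.+ 12 ℕ.* a)) ≡ (Gᴬ * Fᴮ) * E (1ℚ + x₀)
    end-value = cong (λ s → (Gᴬ * Fᴮ) * E s) (trans (frac-+ K (12 ℕ.* a)) (cong (_+ x₀) frac-K))

  binomialRatio≈eSum : binomialRatio a ≈[ (μ * frac lengthA + μ * frac lengthB) + x₀ ] eSum M
  binomialRatio≈eSum = ≈-cong refl refl (sym (eSum≡expSum M)) (≈-trans binomialRatio≈E (≈-sym E[1]≈E[1+x₀]))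
    where
    E[1]≈E[1+x₀] : E 1ℚ ≈[ x₀ ] E (1ℚ + x₀)
    E[1]≈E[1+x₀] = ≈-fromBounds (0≤frac (12 ℕ.* a)) (≤-trans 0≤1 (1≤expSum M 0≤1))
      (expSum-shift-upper M 0≤1 (0≤frac (12 ℕ.* a))) (expSum-mono-≤ M 0≤1 (0≤frac (12 ℕ.* a)))

  error≤ : ℕ→ℚ 2 * recip a + ((μ * frac lengthA + μ * frac lengthB) + x₀) ≤ ℕ→ℚ 7 * recip a + ℕ→ℚ 12 * recip M
  error≤ = begin
    ℕ→ℚ 2 * recip a + ((μ * frac lengthA + μ * frac lengthB) + x₀)
      ≡⟨ cong (λ e → ℕ→ℚ 2 * recip a + (e + x₀)) (error-+ lengthA lengthB) ⟩
    ℕ→ℚ 2 * recip a + (μ * frac (lengthA ℕ.+ lengthB) + x₀)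
      ≤⟨ +-monoʳ-≤ (ℕ→ℚ 2 * recip a) (+-mono-≤ (*-mono-≤-nonNeg 0≤μ (0≤frac (lengthA ℕ.+ lengthB)) μ≤ frac[lengthA+lengthB]≤3) x₀≤) ⟩
    ℕ→ℚ 2 * recip a + ((recip a + ℕ→ℚ 4 * recip M) * ℕ→ℚ 3 + ℕ→ℚ 2 * recip a)
      ≡⟨ collect (recip a) (recip M) ⟩
    ℕ→ℚ 7 * recip a + ℕ→ℚ 12 * recip M ∎
    where
    open ≤-Reasoning
    0≤μ : 0ℚ ≤ μ
    0≤μ = +-nonNeg (0≤recip a) (0≤δ M)
    μ≤ : μ ≤ recip a + ℕ→ℚ 4 * recip M
    μ≤ = +-monoʳ-≤ (recip a) (δ≤4*recip M 2≤M)
    frac[lengthA+lengthB]≤3 : frac (lengthA ℕ.+ lengthB) ≤ ℕ→ℚ 3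
    frac[lengthA+lengthB]≤3 = subst (frac (lengthA ℕ.+ lengthB) ≤_) (*-identityʳ (ℕ→ℚ 3))
      (fraction-≤ {lengthA ℕ.+ lengthB} {3} 1≤K (ℕ.s≤s ℕ.z≤n) (subst (ℕ._≤ 3 ℕ.* K) (sym (ℕₚ.*-identityʳ (lengthA ℕ.+ lengthB))) lengthA+lengthB≤3K))
    x₀≤ : x₀ ≤ ℕ→ℚ 2 * recip a
    x₀≤ = subst (x₀ ≤_) (÷ℕ≡*recip (ℕ→ℚ 2) a)
      (fraction-≤ {12 ℕ.* a} {2} 1≤K 1≤a 12a*a≤2K)
    collect : ∀ r m → ℕ→ℚ 2 * r + ((r + ℕ→ℚ 4 * m) * ℕ→ℚ 3 + ℕ→ℚ 2 * r) ≡ ℕ→ℚ 7 * r + ℕ→ℚ 12 * m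
    collect = solve-∀ ℚ-ring

  approximation : ℕ→ℚ (a ^ 3) * RHS a ≈[ ℕ→ℚ 7 * recip a + ℕ→ℚ 12 * recip M ] ½ * eSum M
  approximation = ≈-weaken error≤
    (≈-cong (trans (*-assoc (ℕ→ℚ (a ^ 3)) (bracket a) (binomialRatio a))
                   (cong (ℕ→ℚ (a ^ 3) *_) (sym (RHS≡bracket*binomialRatio a)))) refl refl
      (≈-* (cube*bracket≈½ a 2≤a) binomialRatio≈eSum))

recip-antimono : ∀ {m n} → 1 ≤ℕ m → m ≤ℕ n → recip n ≤ recip m
recip-antimono {m} {n} 1≤m m≤n = fraction-≤ {1} {1} (ℕₚ.≤-trans 1≤m m≤n) 1≤m
  (subst₂ _≤ℕ_ (sym (ℕₚ.*-identityˡ m)) (sym (ℕₚ.*-identityˡ n)) m≤n)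

recip≤positive : ∀ ε → 0ℚ < ε → ∃[ D ] (1 ≤ℕ D × recip D ≤ ε)
recip≤positive (mkℚ +[1+ p ] d coprime) _ = suc d , ℕ.s≤s ℕ.z≤n ,
  subst (recip (suc d) ≤_) (sym ε≡) (fraction-≤ {1} {suc p} {suc d} {suc d} (ℕ.s≤s ℕ.z≤n) (ℕ.s≤s ℕ.z≤n) (ℕₚ.*-monoˡ-≤ (suc d) (ℕ.s≤s (ℕ.z≤n {p}))))
  where
  ε≡ : mkℚ +[1+ p ] d coprime ≡ ℕ→ℚ (suc p) ÷ℕ suc d
  ε≡ = *ℕ→ℚ≡⇒≡÷ℕ {n = suc d} (ℕ.s≤s ℕ.z≤n) (toℚᵘ-injective (begin
    toℚᵘ (mkℚ +[1+ p ] d coprime * ℕ→ℚ (suc d))             ≈⟨ toℚᵘ-homo-* (mkℚ +[1+ p ] d coprime) (ℕ→ℚ (suc d)) ⟩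
    ℚᵘ.mkℚᵘ +[1+ p ] d ℚᵘ.* toℚᵘ (ℕ→ℚ (suc d))             ≈⟨ ℚᵘₚ.*-congˡ {ℚᵘ.mkℚᵘ +[1+ p ] d} (toℚᵘ-fromℚᵘ (ℚᵘ.mkℚᵘ (+ suc d) 0)) ⟩
    ℚᵘ.mkℚᵘ +[1+ p ] d ℚᵘ.* ℚᵘ.mkℚᵘ (+ suc d) 0            ≈⟨ ℚᵘ.*≡* (cong +[1+_] (identity p d)) ⟩
    ℚᵘ.mkℚᵘ (+ suc p) 0                                    ≈⟨ toℚᵘ-fromℚᵘ (ℚᵘ.mkℚᵘ (+ suc p) 0) ⟨
    toℚᵘ (ℕ→ℚ (suc p))                                     ∎))
    where
    open ℚᵘₚ.≃-Reasoning
    identity : ∀ p d → (d ℕ.+ p ℕ.* suc d) ℕ.* 1 ≡ d ℕ.* 1 ℕ.+ p ℕ.* suc (d ℕ.* 1)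
    identity = solve-∀ ℕ-ring
recip≤positive (mkℚ (+ 0)     d _) (*<* (ℤ.+<+ ()))
recip≤positive (mkℚ -[1+ p ]  d _) (*<* ())

-- With N = 76 D the error (2 + 2) (7/a + 12/m) of the approximation is at most 76/N = 1/D.
error-budget : ∀ {D a m} → 1 ≤ℕ D → 76 ℕ.* D ≤ℕ a → 76 ℕ.* D ≤ℕ m →
  ℕ→ℚ 7 * recip a + ℕ→ℚ 12 * recip m ≤ ℕ→ℚ 19 * recip (76 ℕ.* D)
error-budget {D} {a} {m} 1≤D N≤a N≤m = begin
  ℕ→ℚ 7 * recip a + ℕ→ℚ 12 * recip m
    ≤⟨ +-mono-≤ (*-monoˡ-≤-nonNeg′ (0≤ℕ→ℚ 7) (recip-antimono 1≤N N≤a)) (*-monoˡ-≤-nonNeg′ (0≤ℕ→ℚ 12) (recip-antimono 1≤N N≤m)) ⟩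
  ℕ→ℚ 7 * recip N + ℕ→ℚ 12 * recip N
    ≡⟨ *-distribʳ-+ (recip N) (ℕ→ℚ 7) (ℕ→ℚ 12) ⟨
  (ℕ→ℚ 7 + ℕ→ℚ 12) * recip N
    ≡⟨ cong (_* recip N) (ℕ→ℚ-+ 7 12) ⟨
  ℕ→ℚ 19 * recip N ∎
  where
  open ≤-Reasoning
  N : ℕ
  N = 76 ℕ.* D
  1≤N : 1 ≤ℕ N
  1≤N = ℕₚ.*-mono-≤ {1} {76} (ℕ.s≤s ℕ.z≤n) 1≤D

19/[76D]≤½ : ∀ {D} → 1 ≤ℕ D → ℕ→ℚ 19 * recip (76 ℕ.* D) ≤ ½
19/[76D]≤½ {D} 1≤D = subst (_≤ ½) (÷ℕ≡*recip (ℕ→ℚ 19) (76 ℕ.* D))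
  (fraction-≤ {19} {1} {76 ℕ.* D} {2} (ℕₚ.*-mono-≤ {1} {76} (ℕ.s≤s ℕ.z≤n) 1≤D) (ℕ.s≤s ℕ.z≤n)
    (ℕₚ.≤-trans (ℕₚ.m≤m*n 38 D {{ℕ.>-nonZero 1≤D}})
      (ℕₚ.≤-trans (ℕₚ.*-monoˡ-≤ D (ℕₚ.m≤m+n 38 38)) (ℕₚ.≤-reflexive (sym (ℕₚ.*-identityˡ (76 ℕ.* D)))))))

4*19/[76D]≡1/D : ∀ {D} → 1 ≤ℕ D → (ℕ→ℚ 2 + ℕ→ℚ 2) * (ℕ→ℚ 19 * recip (76 ℕ.* D)) ≡ recip D
4*19/[76D]≡1/D {D} 1≤D = begin
  (ℕ→ℚ 2 + ℕ→ℚ 2) * (ℕ→ℚ 19 * recip (76 ℕ.* D))   ≡⟨ cong (_* (ℕ→ℚ 19 * recip (76 ℕ.* D))) (ℕ→ℚ-+ 2 2) ⟨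
  ℕ→ℚ 4 * (ℕ→ℚ 19 * recip (76 ℕ.* D))             ≡⟨ *-assoc (ℕ→ℚ 4) (ℕ→ℚ 19) (recip (76 ℕ.* D)) ⟨
  ℕ→ℚ 4 * ℕ→ℚ 19 * recip (76 ℕ.* D)               ≡⟨ cong (_* recip (76 ℕ.* D)) (ℕ→ℚ-* 4 19) ⟨
  ℕ→ℚ 76 * recip (76 ℕ.* D)                       ≡⟨ cong (ℕ→ℚ 76 *_) (recip-* {76} (ℕ.s≤s ℕ.z≤n) 1≤D) ⟩
  ℕ→ℚ 76 * (recip 76 * recip D)                   ≡⟨ *-assoc (ℕ→ℚ 76) (recip 76) (recip D) ⟨
  ℕ→ℚ 76 * recip 76 * recip D                     ≡⟨ cong (_* recip D) (ℕ→ℚ*recip≡1 {76} (ℕ.s≤s ℕ.z≤n)) ⟩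
  1ℚ * recip D                                    ≡⟨ *-identityˡ (recip D) ⟩
  recip D                                         ∎
  where open ≡-Reasoning

approximation-error≤ : ∀ {D} a m → 1 ≤ℕ D → 76 ℕ.* D ≤ℕ a → 76 ℕ.* D ≤ℕ m →
  ∣ ℕ→ℚ (a ^ 3) * RHS a - ½ * eSum m ∣ ≤ recip D
approximation-error≤ {D} a m 1≤D N≤a N≤m = begin
  ∣ ℕ→ℚ (a ^ 3) * RHS a - ½ * eSum m ∣
    ≤⟨ ≈⇒∣-∣≤ τ≤½ ½*eSum≤2 (Approximation.approximation a m 5≤a 2≤m) ⟩
  (ℕ→ℚ 2 + ℕ→ℚ 2) * τ
    ≤⟨ *-monoˡ-≤-nonNeg′ (+-nonNeg (0≤ℕ→ℚ 2) (0≤ℕ→ℚ 2)) (error-budget 1≤D N≤a N≤m) ⟩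
  (ℕ→ℚ 2 + ℕ→ℚ 2) * (ℕ→ℚ 19 * recip (76 ℕ.* D))
    ≡⟨ 4*19/[76D]≡1/D 1≤D ⟩
  recip D ∎
  where
  open ≤-Reasoning
  τ : ℚ
  τ = ℕ→ℚ 7 * recip a + ℕ→ℚ 12 * recip m
  τ≤½ : τ ≤ ½
  τ≤½ = ≤-trans (error-budget 1≤D N≤a N≤m) (19/[76D]≤½ 1≤D)
  ½*eSum≤2 : ½ * eSum m ≤ ℕ→ℚ 2
  ½*eSum≤2 = subst (λ e → ½ * e ≤ ℕ→ℚ 2) (sym (eSum≡expSum m)) (½*expSum-at-1≤2 m)
  76≤ : ∀ {n k} → 76 ℕ.* D ≤ℕ n → k ≤ℕ 76 → k ≤ℕ n
  76≤ N≤n k≤76 = ℕₚ.≤-trans k≤76 (ℕₚ.≤-trans (ℕₚ.m≤m*n 76 D {{ℕ.>-nonZero 1≤D}}) N≤n)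
  5≤a : 5 ≤ℕ a
  5≤a = 76≤ N≤a (ℕₚ.m≤m+n 5 71)
  2≤m : 2 ≤ℕ m
  2≤m = 76≤ N≤m (ℕₚ.m≤m+n 2 74)

lemma4p2 : (ε : ℚ) → 0ℚ < ε →
  ∃[ N ] ((a m : ℕ) → 1 ≤ℕ a → N ≤ℕ a → N ≤ℕ m →
    ∣ ℕ→ℚ (a ^ 3) * RHS a - ½ * eSum m ∣ ≤ ε)
lemma4p2 ε 0<ε = 76 ℕ.* D , λ a m _ N≤a N≤m → ≤-trans (approximation-error≤ a m 1≤D N≤a N≤m) 1/D≤ε
  where
  D : ℕ
  D = proj₁ (recip≤positive ε 0<ε)
  1≤D : 1 ≤ℕ D
  1≤D = proj₁ (proj₂ (recip≤positive ε 0<ε))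
  1/D≤ε : recip D ≤ ε
  1/D≤ε = proj₂ (proj₂ (recip≤positive ε 0<ε))
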